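{- Let $v\in\{0,\ldots,n-1\}^k$ lie in a region $R_\alpha$. For a random input $f\sim\mathcal{U}$, the value $f(v)$ is independent of the locations of the spine vertices of $f$ in all regions other than (possibly) the regions $R_{\alpha+i\rho}$ for $i\in\{ -2,-1,0,1,2\}$.
   Context: Fix positive integers $n,k,L,\rho$ with $\rho\mid k(n-1)$, $k\mid\rho$, $\rho\ge 12kL$. Order $\{0,\ldots,n-1\}^k$ componentwise; $wt(x)=\sum_i x_i$. Tube: $T_L=\{x\in\{0,\ldots,n-1\}^k:\exists i\in\{0,\ldots,n-1\},|x_c-i|\le L\ \forall c\}$. Let $\mathcal{I}=\{a\in\{0,\ldots,k(n-1)\}:\rho\mid a\}$; for $a\in\mathcal{I}\setminus\{k(n-1)\}$ the region is $R_a=\{x\in T_L: a\le wt(x)\le a+\rho\}$, and $Low_a=\{x\in T_L: wt(x)=a\}$ for $a\in\mathcal{I}$. $\mathcal{C}(w)$ is the closed unit cube centered at $w$, $\ell(u,v)$ the closed segment. A monotone connected path is a sequence of vertices each obtained from the previous by adding a standard unit vector. Given connecting points $\chi_i\in Low_i$ ($i\in\mathcal{I}$), for each consecutive pair $\chi_i,\chi_{i+\rho}$ let $(s^i,\ldots,s^{i+\rho})$ be the lexicographically smallest (first vertex smallest lexicographically, then second, etc.) sequence that starts at $\chi_i$, ends at $\chi_{i+\rho}$, is a monotone connected path and has $\mathcal{C}(s^t)\cap\ell(\chi_i,\chi_{i+\rho})\ne\emptyset$ for all its vertices; the induced spine is $\mathbf{s}=(s^0,\ldots,s^{k(n-1)})$.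 $\Psi$ is the set of all induced spines. For a spine $\mathbf{s}$ and $j$, with $M(v)=\min\{i:s^i\ge v\}$, $\mu(v)=\max\{i:s^i\le v\}$, the herringbone function is $h^{\mathbf{s},j}(v)=v$ if $v=s^j$; $s^{i+1}$ if $v=s^i,i<j$; $s^{i-1}$ if $v=s^i,i>j$; $v+(s^{\mu(v)+1}-s^{\mu(v)})-(s^{M(v)}-s^{M(v)-1})$ otherwise. $\mathcal{F}=\{h^{\mathbf{s},j}:\mathbf{s}\in\Psi,j\in\{0,\ldots,k(n-1)\}\}$ and $\mathcal{U}$ is the uniform distribution on $\mathcal{F}$. The spine vertices of $f=h^{\mathbf{s},j}$ are the entries of $\mathbf{s}$. -}

module Defs where

open import Data.Bool using (Bool; true; false; if_then_else_; _∧_)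
open import Data.Nat as ℕ using (ℕ; zero; suc; _∸_)
open import Data.Nat.Divisibility using (_∣_; _∣?_)
import Data.Nat.Properties as ℕP
open import Data.Integer as ℤ using (ℤ; +_; 0ℤ; 1ℤ)
import Data.Integer.Properties as ℤP
open import Data.Rational as ℚ using (ℚ; 0ℚ; 1ℚ; ½)
open import Data.Fin as Fin using (Fin; toℕ; inject₁)
import Data.Fin.Properties as FinP
open import Data.Vec as Vec using (Vec; []; _∷_; lookup; tabulate; zipWith; head; last)
import Data.Vec.Properties as VecP
open import Data.Vec.Relation.Unary.All as All using (All)
open import Data.Vec.Relation.Unary.Any as Any using (Any)
open import Data.Maybe using (Maybe; just; nothing)
import Data.Maybe.Properties as MaybeP
open import Data.List as List using (List; length; filter; cartesianProduct; allFin)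
open import Data.Product using (Σ; ∃; _×_; _,_; proj₁; proj₂)
open import Data.Sum using (_⊎_)
open import Data.Empty using (⊥)
open import Relation.Nullary using (Dec; yes; no; ¬_; does)
open import Relation.Nullary.Decidable using (_×-dec_; _⊎-dec_; ¬?; ⌊_⌋)
open import Relation.Binary.PropositionalEquality using (_≡_)
open import Relation.Binary.Definitions using (tri<; tri≈; tri>)

-- Points of ℤ^k (grid points {0..n-1}^k are the points satisfying InGrid)

Point : ℕ → Set
Point k = Vec ℤ k

_⊕_ : ∀ {k} → Point k → Point k → Point k
_⊕_ = zipWith ℤ._+_

_⊖_ : ∀ {k} → Point k → Point k → Point k
_⊖_ = zipWith ℤ._-_

wt : ∀ {k} → Point k → ℤ
wt []      = 0ℤ
wt (c ∷ x) = c ℤ.+ wt x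

unitVec : ∀ {k} → Fin k → Point k
unitVec c = tabulate (λ d → if ⌊ c FinP.≟ d ⌋ then 1ℤ else 0ℤ)

_≤ᵖ_ : ∀ {k} → Point k → Point k → Bool
[]      ≤ᵖ []      = true
(a ∷ x) ≤ᵖ (b ∷ y) = (a ℤ.≤ᵇ b) ∧ (x ≤ᵖ y)

InGrid : ∀ {k} → ℕ → Point k → Set
InGrid n x = All (λ c → (0ℤ ℤ.≤ c) × (c ℤ.< + n)) x

inGrid? : ∀ {k} (n : ℕ) (x : Point k) → Dec (InGrid n x)
inGrid? n x = All.all? (λ c → (0ℤ ℤ.≤? c) ×-dec (c ℤ.<? + n)) x

InTube : ∀ {k} → ℕ → ℕ → Point k → Set
InTube n L x = InGrid n x × ∃ λ (i : Fin n) → All (λ c → ℤ.∣ c ℤ.- + toℕ i ∣ ℕ.≤ L) x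

inTube? : ∀ {k} (n L : ℕ) (x : Point k) → Dec (InTube n L x)
inTube? n L x = inGrid? n x ×-dec
  FinP.any? (λ i → All.all? (λ c → ℤ.∣ c ℤ.- + toℕ i ∣ ℕ.≤? L) x)

-- region R_a (a ranges over I \ {k(n-1)})
InRegion : ∀ {k} → ℕ → ℕ → ℕ → ℕ → Point k → Set
InRegion n L ρ a x = InTube n L x × (+ a ℤ.≤ wt x) × (wt x ℤ.≤ + (a ℕ.+ ρ))

inRegion? : ∀ {k} (n L ρ a : ℕ) (x : Point k) → Dec (InRegion n L ρ a x)
inRegion? n L ρ a x = inTube? n L x ×-dec ((+ a ℤ.≤? wt x) ×-dec (wt x ℤ.≤? + (a ℕ.+ ρ)))

InLow : ∀ {k} → ℕ → ℕ → ℕ → Point k → Set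
InLow n L a x = InTube n L x × (wt x ≡ + a)

Step : ∀ {k} → Point k → Point k → Set
Step x y = ∃ λ c → y ≡ x ⊕ unitVec c

MonotonePath : ∀ {k m} → Vec (Point k) (suc m) → Set
MonotonePath {m = m} p = (t : Fin m) → Step (lookup p (inject₁ t)) (lookup p (Fin.suc t))

toℚ : ℤ → ℚ
toℚ z = z ℚ./ 1

CubeMeetsSegment : ∀ {k} → Point k → Point k → Point k → Set
CubeMeetsSegment {k} w u v =
  ∃ λ (t : ℚ) → (0ℚ ℚ.≤ t) × (t ℚ.≤ 1ℚ) ×
    ((c : Fin k) →
      ℚ.∣ (toℚ (lookup u c) ℚ.+ t ℚ.* (toℚ (lookup v c) ℚ.- toℚ (lookup u c)))
          ℚ.- toℚ (lookup w c) ∣ ℚ.≤ ½)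

Lex< : {A : Set} → (A → A → Set) → ∀ {m} → Vec A m → Vec A m → Set
Lex< _<_ []       []       = ⊥
Lex< _<_ (x ∷ xs) (y ∷ ys) = (x < y) ⊎ ((x ≡ y) × Lex< _<_ xs ys)

_<ᴾ_ : ∀ {k} → Point k → Point k → Set
_<ᴾ_ = Lex< ℤ._<_

_<ᴸ_ : ∀ {k m} → Vec (Point k) m → Vec (Point k) m → Set
_<ᴸ_ = Lex< _<ᴾ_

Admissible : ∀ {k} ρ → Point k → Point k → Vec (Point k) (suc ρ) → Set
Admissible ρ u v p =
  (head p ≡ u) × (last p ≡ v) × MonotonePath p ×
  ((t : Fin (suc ρ)) → CubeMeetsSegment (lookup p t) u v)

LexMinAdmissible : ∀ {k} ρ → Point k → Point k → Vec (Point k) (suc ρ) → Set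
LexMinAdmissible ρ u v p =
  Admissible ρ u v p × ((q : Vec _ (suc ρ)) → Admissible ρ u v q → (p ≡ q) ⊎ (p <ᴸ q))

-- total index into a nonempty vector (clamped at the last entry)
at : {A : Set} {m : ℕ} → Vec A (suc m) → ℕ → A
at (x ∷ [])     _       = x
at (x ∷ y ∷ xs) zero    = x
at (x ∷ y ∷ xs) (suc i) = at (y ∷ xs) i

topIndex : ℕ → ℕ → ℕ
topIndex n k = k ℕ.* (n ∸ 1)

Spine : ℕ → ℕ → Set
Spine n k = Vec (Point k) (suc (topIndex n k))

block : ∀ {m k} ρ → Vec (Point k) (suc m) → ℕ → Vec (Point k) (suc ρ)
block ρ s a = tabulate (λ t → at s (a ℕ.+ toℕ t))

-- s ∈ Ψ: the connecting points χ_a = s^a lie in Low_a (a ∈ I), and each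
-- segment between consecutive connecting points is the lexicographically
-- smallest admissible monotone path.
IsInducedSpine : ∀ n k L ρ → Spine n k → Set
IsInducedSpine n k L ρ s =
  ((a : ℕ) → a ℕ.≤ topIndex n k → ρ ∣ a → InLow n L a (at s a)) ×
  ((a : ℕ) → a ℕ.< topIndex n k → ρ ∣ a →
     LexMinAdmissible ρ (at s a) (at s (a ℕ.+ ρ)) (block ρ s a))

-- first i ∈ {i₀,…,i₀+fuel} with p i (or i₀+fuel if none)
searchUp : (ℕ → Bool) → ℕ → ℕ → ℕ
searchUp p zero       i = i
searchUp p (suc fuel) i = if p i then i else searchUp p fuel (suc i)

-- last i ≤ i₀ with p i (or 0 if none)
searchDown : (ℕ → Bool) → ℕ → ℕ
searchDown p zero    = zero
searchDown p (suc i) = if p (suc i) then suc i else searchDown p i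

bigM : ∀ {m k} → Vec (Point k) (suc m) → Point k → ℕ
bigM {m} s v = searchUp (λ i → v ≤ᵖ at s i) m 0

smallμ : ∀ {m k} → Vec (Point k) (suc m) → Point k → ℕ
smallμ {m} s v = searchDown (λ i → at s i ≤ᵖ v) m

_≟ᵖ_ : ∀ {k} (x y : Point k) → Dec (x ≡ y)
_≟ᵖ_ = VecP.≡-dec ℤ._≟_

herringOnSpine : ∀ {m k} → Vec (Point k) (suc m) → ℕ → Point k → ℕ → Point k
herringOnSpine s j v i with ℕP.<-cmp i j
... | tri< _ _ _ = at s (suc i)
... | tri≈ _ _ _ = v
... | tri> _ _ _ = at s (i ∸ 1)

herringbone : ∀ {m k} → Vec (Point k) (suc m) → ℕ → Point k → Point k
herringbone s j v with Any.any? (λ x → x ≟ᵖ v) s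
... | yes p = herringOnSpine s j v (toℕ (Any.index p))
... | no _  = (v ⊕ (at s (suc μ) ⊖ at s μ)) ⊖ (at s M ⊖ at s (M ∸ 1))
  where
    μ = smallμ s v
    M = bigM s v

NearIndex : ℕ → ℕ → ℕ → Set
NearIndex α ρ b =
  (b ℕ.+ 2 ℕ.* ρ ≡ α) ⊎ (b ℕ.+ ρ ≡ α) ⊎ (b ≡ α) ⊎ (b ≡ α ℕ.+ ρ) ⊎ (b ≡ α ℕ.+ 2 ℕ.* ρ)

nearIndex? : ∀ α ρ b → Dec (NearIndex α ρ b)
nearIndex? α ρ b =
  (b ℕ.+ 2 ℕ.* ρ ℕ.≟ α) ⊎-dec (b ℕ.+ ρ ℕ.≟ α) ⊎-dec (b ℕ.≟ α) ⊎-dec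
  (b ℕ.≟ α ℕ.+ ρ) ⊎-dec (b ℕ.≟ α ℕ.+ 2 ℕ.* ρ)

InOtherRegion : ∀ n k L ρ α → Point k → Set
InOtherRegion n k L ρ α x =
  ∃ λ (b : Fin (topIndex n k)) →
    (ρ ∣ toℕ b) × ¬ NearIndex α ρ (toℕ b) × InRegion n L ρ (toℕ b) x

inOtherRegion? : ∀ n k L ρ α (x : Point k) → Dec (InOtherRegion n k L ρ α x)
inOtherRegion? n k L ρ α x =
  FinP.any? (λ b → (ρ ∣? toℕ b) ×-dec (¬? (nearIndex? α ρ (toℕ b))) ×-dec inRegion? n L ρ (toℕ b) x)

-- the locations of the spine vertices lying in regions other than R_{α+iρ}
-- (entry t is just s^t if s^t lies in such a region, nothing otherwise)
otherSpineVertices : ∀ n k L ρ α → Spine n k → Vec (Maybe (Point k)) (suc (topIndex n k))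
otherSpineVertices n k L ρ α s =
  Vec.map (λ x → if does (inOtherRegion? n k L ρ α x) then just x else nothing) s

-- Independence of two random variables under the uniform distribution on
-- a finite sample space, given as a list of its (distinct) elements:
-- |Ω| · #{X = a ∧ Y = b} = #{X = a} · #{Y = b} for all a, b.

count : {Ω : Set} (P : Ω → Bool) → List Ω → ℕ
count P List.[]       = 0
count P (ω List.∷ xs) = if P ω then suc (count P xs) else count P xs

IndependentUniform : {Ω A B : Set} → List Ω →
  (X : Ω → A) → ((a a′ : A) → Dec (a ≡ a′)) →
  (Y : Ω → B) → ((b b′ : B) → Dec (b ≡ b′)) → Set
IndependentUniform Ω X _≟A_ Y _≟B_ =
  ∀ a b →
    length Ω ℕ.* count (λ ω → does (X ω ≟A a) ∧ does (Y ω ≟B b)) Ω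
      ≡ count (λ ω → does (X ω ≟A a)) Ω ℕ.* count (λ ω → does (Y ω ≟B b)) Ω

_≟ᵒ_ : ∀ {k m} (x y : Vec (Maybe (Point k)) m) → Dec (x ≡ y)
_≟ᵒ_ = VecP.≡-dec (MaybeP.≡-dec _≟ᵖ_)

-- the sample space {(s, j) : s ∈ Ψ, j ∈ {0,…,k(n-1)}}, Ψ listed by ℓ
sampleSpace : ∀ n k → List (Spine n k) → List (Spine n k × Fin (suc (topIndex n k)))
sampleSpace n k ℓ = cartesianProduct ℓ (allFin (suc (topIndex n k)))

module Submission where

-- Write Ψ as a list ℓ of spines and sample (s , j) uniformly from ℓ × {0 … K}. An induced
-- spine is determined by its connecting points, and conversely every choice of connecting points
-- χ_a ∈ Low_a induces a spine: since ρ ≥ 4kL the tube forces χ_a ≤ χ_{a+ρ}, a greedy monotone path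
-- from χ_a to χ_{a+ρ} keeps all its unit cubes on the segment, and so a lexicographically least
-- admissible path exists. The value h^{s,j}(v) only involves spine vertices with index in the window
-- [α − ρ, α + 2ρ], while a spine vertex of weight t can lie in a region R_b with b ∉ α + ρ{-2,…,2}
-- only if t ≤ α − 2ρ or t ≥ α + 3ρ. Mixing two spines, taking the connecting points inside the
-- window from the first and the others from the second, is therefore an involution on pairs of
-- spines that keeps f(v) of the first and the far spine vertices of the second, and counting over
-- pairs gives independence.

open import Defs
open import Algebra.Bundles using (AbelianGroup)
import Algebra.Properties.CommutativeSemigroup as CommutativeSemigroupProperties
import Algebra.Properties.Group as GroupProperties
open import Data.Bool as Bool using (Bool; true; false; if_then_else_; _∧_)
open import Data.Empty using (⊥-elim)
open import Data.Fin as Fin using (Fin; toℕ; fromℕ<)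
import Data.Fin.Properties as FinP
open import Data.Integer as ℤ using (ℤ; +_; 0ℤ; 1ℤ; -[1+_])
import Data.Integer.Properties as ℤP
open import Data.Integer.Tactic.RingSolver using (solve-∀)
open import Data.List using (List; []; _∷_; length; map; _++_; allFin; filter; cartesianProduct; cartesianProductWith)
open import Data.List.Membership.Propositional using (_∈_)
open import Data.List.Membership.Propositional.Properties
  using (∈-allFin; ∈-filter⁺; ∈-filter⁻; ∈-map⁺; ∈-map⁻; ∈-cartesianProduct⁺; ∈-cartesianProduct⁻;
         ∈-cartesianProductWith⁺)
open import Data.List.Relation.Unary.All as All using (All; []; _∷_)
open import Data.List.Relation.Unary.Any using (here; there)
open import Data.List.Relation.Unary.Unique.Propositional using (Unique; []; _∷_)
import Data.List.Relation.Unary.Unique.Propositional.Properties as Unique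
open import Data.Maybe using (Maybe; just; nothing)
open import Data.Nat as ℕ using (ℕ; zero; suc; _+_; _*_; _∸_; _≤_; _<_; z≤n; s≤s; NonZero)
open import Data.Nat.DivMod
  using (_/_; _%_; m≡m%n+[m/n]*n; m%n<n; +-distrib-/-∣ˡ; m*n/n≡m; m<n⇒m/n≡0; [m+kn]%n≡m%n; m<n⇒m%n≡m)
open import Data.Nat.Divisibility using (_∣_; divides; ∣-refl; ∣m∣n⇒∣m+n; ∣n⇒∣m*n; ∣m+n∣m⇒∣n)
import Data.Nat.Properties as ℕP
import Data.Nat.Tactic.RingSolver as ℕ-Solver
open import Data.Product using (Σ; ∃; _×_; _,_; proj₁; proj₂)
import Data.Product.Properties as Product
open import Data.Rational as ℚ using (ℚ; 0ℚ; 1ℚ; ½)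
import Data.Rational.Properties as ℚP
open import Data.Rational.Solver using (module +-*-Solver)
open +-*-Solver using (solve)
open import Data.Rational.Unnormalised as ℚᵘ using (mkℚᵘ; *≡*; *≤*)
import Data.Rational.Unnormalised.Properties as ℚᵘP
open import Data.Sum using (_⊎_; inj₁; inj₂)
import Data.Sum as Sum
open import Data.Unit using (tt)
open import Data.Vec using (Vec; []; _∷_; lookup; head; last; replicate; tabulate)
open import Data.Vec.Membership.Propositional.Properties using (∈-lookup)
import Data.Vec.Properties as VecP
open import Data.Vec.Relation.Unary.All as VecAll using ([]; _∷_)
import Data.Vec.Relation.Unary.All.Properties as VecAllP
open import Data.Vec.Relation.Unary.Any as Any using (Any)
import Data.Vec.Relation.Unary.Any.Properties as AnyP
open import Function using (id; _∘_)
open import Function.Bundles using (_⇔_; Equivalence)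
open import Relation.Binary.Bundles using (StrictTotalOrder; DecTotalOrder)
open import Relation.Binary.Definitions using (DecidableEquality; Trichotomous; tri<; tri≈; tri>)
open import Relation.Binary.PropositionalEquality
import Relation.Binary.Properties.StrictTotalOrder as StrictTotalOrderProperties
open import Relation.Binary.Structures using (IsStrictTotalOrder)
open import Relation.Nullary using (Dec; yes; no; ¬_; does)
open import Relation.Nullary.Decidable
  using (_×-dec_; _⊎-dec_; ⌊_⌋; ⌊⌋-map′; isYes≗does; dec-true; dec-false; map′)
open import Relation.Unary using (Decidable)

private
  module +-CS = CommutativeSemigroupProperties ℕP.+-commutativeSemigroup
  module *-CS = CommutativeSemigroupProperties ℕP.*-commutativeSemigroup
  module +-Group = GroupProperties (AbelianGroup.group ℤP.+-0-abelianGroup)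

private
  variable
    A B : Set
    m : ℕ

-- Finite sums and independence by swapping

∑ : (A → ℕ) → List A → ℕ
∑ f []       = 0
∑ f (x ∷ xs) = f x + ∑ f xs

[_]·_ : Bool → ℕ → ℕ
[ b ]· n = if b then n else 0

∑-cong : {f g : A → ℕ} (xs : List A) → (∀ {x} → x ∈ xs → f x ≡ g x) → ∑ f xs ≡ ∑ g xs
∑-cong []       f≡g = refl
∑-cong (x ∷ xs) f≡g = cong₂ _+_ (f≡g (here refl)) (∑-cong xs (λ x∈xs → f≡g (there x∈xs)))

∑-++ : (f : A → ℕ) (xs ys : List A) → ∑ f (xs ++ ys) ≡ ∑ f xs + ∑ f ys
∑-++ f []       ys = refl
∑-++ f (x ∷ xs) ys = trans (cong (λ s → f x + s) (∑-++ f xs ys)) (sym (ℕP.+-assoc (f x) _ _))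

∑-map : (f : B → ℕ) (g : A → B) (xs : List A) → ∑ f (map g xs) ≡ ∑ (λ x → f (g x)) xs
∑-map f g []       = refl
∑-map f g (x ∷ xs) = cong (λ s → f (g x) + s) (∑-map f g xs)

∑-zero : (xs : List A) → ∑ (λ _ → 0) xs ≡ 0
∑-zero []       = refl
∑-zero (x ∷ xs) = ∑-zero xs

∑-const : (c : ℕ) (xs : List A) → ∑ (λ _ → c) xs ≡ length xs * c
∑-const c []       = refl
∑-const c (x ∷ xs) = cong (λ s → c + s) (∑-const c xs)

∑-+ : (f g : A → ℕ) (xs : List A) → ∑ (λ x → f x + g x) xs ≡ ∑ f xs + ∑ g xs
∑-+ f g []       = refl
∑-+ f g (x ∷ xs) = trans (cong (λ s → f x + g x + s) (∑-+ f g xs)) (+-CS.interchange (f x) (g x) _ _)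

∑-*ˡ : (c : ℕ) (f : A → ℕ) (xs : List A) → ∑ (λ x → c * f x) xs ≡ c * ∑ f xs
∑-*ˡ c f []       = sym (ℕP.*-zeroʳ c)
∑-*ˡ c f (x ∷ xs) = trans (cong (λ s → c * f x + s) (∑-*ˡ c f xs)) (sym (ℕP.*-distribˡ-+ c (f x) (∑ f xs)))

∑-*ʳ : (c : ℕ) (f : A → ℕ) (xs : List A) → ∑ (λ x → f x * c) xs ≡ ∑ f xs * c
∑-*ʳ c f xs = trans (∑-cong xs (λ {x} _ → ℕP.*-comm (f x) c)) (trans (∑-*ˡ c f xs) (ℕP.*-comm c _))

∑-swap : (g : A → B → ℕ) (xs : List A) (ys : List B) →
         ∑ (λ x → ∑ (g x) ys) xs ≡ ∑ (λ y → ∑ (λ x → g x y) xs) ys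
∑-swap g []       ys = sym (∑-zero ys)
∑-swap g (x ∷ xs) ys = trans (cong (λ s → ∑ (g x) ys + s) (∑-swap g xs ys))
                             (sym (∑-+ (g x) (λ y → ∑ (λ x → g x y) xs) ys))

∑-cartesianProduct : (f : A × B → ℕ) (xs : List A) (ys : List B) →
                     ∑ f (cartesianProduct xs ys) ≡ ∑ (λ x → ∑ (λ y → f (x , y)) ys) xs
∑-cartesianProduct f []       ys = refl
∑-cartesianProduct f (x ∷ xs) ys = trans (∑-++ f (map (x ,_) ys) _)
  (cong₂ _+_ (∑-map f (x ,_) ys) (∑-cartesianProduct f xs ys))

count≡∑ : (P : A → Bool) (xs : List A) → count P xs ≡ ∑ (λ x → [ P x ]· 1) xs
count≡∑ P []       = refl
count≡∑ P (x ∷ xs) with P x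
... | true  = cong suc (count≡∑ P xs)
... | false = count≡∑ P xs

length≡∑ : (xs : List A) → length xs ≡ ∑ (λ _ → 1) xs
length≡∑ []       = refl
length≡∑ (x ∷ xs) = cong suc (length≡∑ xs)

indicator-∧ : ∀ x y → [ x ∧ y ]· 1 ≡ [ x ]· 1 * [ y ]· 1
indicator-∧ true  true  = refl
indicator-∧ true  false = refl
indicator-∧ false _     = refl

module _ (_≟_ : DecidableEquality A) where

  ∑-pick-∉ : (z : A) (f : A → ℕ) (xs : List A) → All (λ y → ¬ z ≡ y) xs →
             ∑ (λ y → [ does (z ≟ y) ]· f y) xs ≡ 0
  ∑-pick-∉ z f []       _          = refl
  ∑-pick-∉ z f (x ∷ xs) (z≢x ∷ z∉) with z ≟ x
  ... | yes z≡x = ⊥-elim (z≢x z≡x)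
  ... | no  _   = ∑-pick-∉ z f xs z∉

  ∑-pick : (z : A) (f : A → ℕ) (xs : List A) → Unique xs → z ∈ xs →
           ∑ (λ y → [ does (z ≟ y) ]· f y) xs ≡ f z
  ∑-pick z f (x ∷ xs) (x∉ ∷ _) (here refl) with z ≟ z
  ... | yes _   = trans (cong (λ s → f z + s) (∑-pick-∉ z f xs x∉)) (ℕP.+-identityʳ (f z))
  ... | no  z≢z = ⊥-elim (z≢z refl)
  ∑-pick z f (x ∷ xs) (x∉ ∷ u) (there z∈xs) with z ≟ x
  ... | yes refl = ⊥-elim (All.lookup x∉ z∈xs refl)
  ... | no  _    = ∑-pick z f xs u z∈xs

  -- Σₓ H (Φ x) = Σₓ Σ_y [Φ x = y] H y = Σ_y Σₓ [Φ y = x] H y = Σ_y H y.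
  ∑-involution : (Φ : A → A) (H : A → ℕ) (xs : List A) → Unique xs →
                 (∀ {x} → x ∈ xs → Φ x ∈ xs) → (∀ {x} → x ∈ xs → Φ (Φ x) ≡ x) →
                 ∑ (λ x → H (Φ x)) xs ≡ ∑ H xs
  ∑-involution Φ H xs u Φ∈ ΦΦ = begin
    ∑ (λ x → H (Φ x)) xs
      ≡⟨ ∑-cong xs (λ x∈ → sym (∑-pick (Φ _) H xs u (Φ∈ x∈))) ⟩
    ∑ (λ x → ∑ (λ y → [ does (Φ x ≟ y) ]· H y) xs) xs
      ≡⟨ ∑-swap (λ x y → [ does (Φ x ≟ y) ]· H y) xs xs ⟩
    ∑ (λ y → ∑ (λ x → [ does (Φ x ≟ y) ]· H y) xs) xs
      ≡⟨ ∑-cong xs (λ {y} y∈ → trans (∑-cong xs (λ x∈ → flip x∈ y∈)) (∑-pick (Φ y) (λ _ → H y) xs u (Φ∈ y∈))) ⟩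
    ∑ H xs ∎
    where
    open ≡-Reasoning
    flip : ∀ {x y} → x ∈ xs → y ∈ xs → [ does (Φ x ≟ y) ]· H y ≡ [ does (Φ y ≟ x) ]· H y
    flip {x} {y} x∈ y∈ with Φ x ≟ y | Φ y ≟ x
    ... | yes _    | yes _    = refl
    ... | no  _    | no  _    = refl
    ... | yes refl | no  ne   = ⊥-elim (ne (ΦΦ x∈))
    ... | no  ne   | yes refl = ⊥-elim (ne (ΦΦ y∈))

-- The involution (s , s′) ↦ (mix s s′ , mix s′ s) of ℓ × ℓ turns Σ F s G s into Σ F s G s′.
length*∑-by-swapping : DecidableEquality A → (ℓ : List A) → Unique ℓ → (F G : A → ℕ) (mix : A → A → A) →
                       (∀ {s s′} → s ∈ ℓ → s′ ∈ ℓ → mix s s′ ∈ ℓ) →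
                       (∀ {s s′} → s ∈ ℓ → s′ ∈ ℓ → F (mix s s′) ≡ F s) →
                       (∀ {s s′} → s ∈ ℓ → s′ ∈ ℓ → G (mix s s′) ≡ G s′) →
                       (∀ {s s′} → s ∈ ℓ → s′ ∈ ℓ → mix (mix s s′) (mix s′ s) ≡ s) →
                       length ℓ * ∑ (λ s → F s * G s) ℓ ≡ ∑ F ℓ * ∑ G ℓ
length*∑-by-swapping {A} _≟_ ℓ unique F G mix mix∈ F-mix G-mix mix-involutive = begin
  length ℓ * ∑ (λ s → F s * G s) ℓ
    ≡⟨ sym (trans (∑-cartesianProduct FG₁ ℓ ℓ) (trans (∑-cong ℓ (λ {s} _ → ∑-const (F s * G s) ℓ)) (∑-*ˡ (length ℓ) _ ℓ))) ⟩
  ∑ FG₁ P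
    ≡⟨ sym (∑-involution (Product.≡-dec _≟_ _≟_) swap FG₁ P (Unique.cartesianProduct⁺ unique unique) swap∈ swap-involutive) ⟩
  ∑ (λ p → FG₁ (swap p)) P
    ≡⟨ ∑-cong P FG₁∘swap ⟩
  ∑ (λ p → F (proj₁ p) * G (proj₂ p)) P
    ≡⟨ trans (∑-cartesianProduct _ ℓ ℓ) (trans (∑-cong ℓ (λ {s} _ → ∑-*ˡ (F s) G ℓ)) (∑-*ʳ _ F ℓ)) ⟩
  ∑ F ℓ * ∑ G ℓ ∎
  where
  open ≡-Reasoning
  P = cartesianProduct ℓ ℓ
  swap : A × A → A × A
  swap (s , s′) = mix s s′ , mix s′ s
  FG₁ : A × A → ℕ
  FG₁ (s , _) = F s * G s
  swap∈ : ∀ {p} → p ∈ P → swap p ∈ P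
  swap∈ {s , s′} p∈ with ∈-cartesianProduct⁻ ℓ ℓ p∈
  ... | s∈ , s′∈ = ∈-cartesianProduct⁺ (mix∈ s∈ s′∈) (mix∈ s′∈ s∈)
  swap-involutive : ∀ {p} → p ∈ P → swap (swap p) ≡ p
  swap-involutive {s , s′} p∈ with ∈-cartesianProduct⁻ ℓ ℓ p∈
  ... | s∈ , s′∈ = cong₂ _,_ (mix-involutive s∈ s′∈) (mix-involutive s′∈ s∈)
  FG₁∘swap : ∀ {p} → p ∈ P → FG₁ (swap p) ≡ F (proj₁ p) * G (proj₂ p)
  FG₁∘swap {s , s′} p∈ with ∈-cartesianProduct⁻ ℓ ℓ p∈
  ... | s∈ , s′∈ = cong₂ _*_ (F-mix s∈ s′∈) (G-mix s∈ s′∈)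

independent-by-swapping :
  {S I A B : Set} → DecidableEquality S → (ℓ : List S) → Unique ℓ → (J : List I) →
  (X : S × I → A) (_≟A_ : DecidableEquality A) (Y : S → B) (_≟B_ : DecidableEquality B) →
  (mix : S → S → S) →
  (∀ {s s′} → s ∈ ℓ → s′ ∈ ℓ → mix s s′ ∈ ℓ) →
  (∀ {s s′} → s ∈ ℓ → s′ ∈ ℓ → ∀ j → X (mix s s′ , j) ≡ X (s , j)) →
  (∀ {s s′} → s ∈ ℓ → s′ ∈ ℓ → Y (mix s s′) ≡ Y s′) →
  (∀ {s s′} → s ∈ ℓ → s′ ∈ ℓ → mix (mix s s′) (mix s′ s) ≡ s) →
  IndependentUniform (cartesianProduct ℓ J) X _≟A_ (λ sj → Y (proj₁ sj)) _≟B_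
independent-by-swapping {S} {I} _≟S_ ℓ unique J X _≟A_ Y _≟B_ mix mix∈ X-mix Y-mix mix-involutive a b = begin
  length Ω * count (λ ω → does (X ω ≟A a) ∧ does (Y (proj₁ ω) ≟B b)) Ω
    ≡⟨ cong₂ _*_ length-Ω count-X∧Y ⟩
  length ℓ * length J * ∑ (λ s → #X s * #Y s) ℓ
    ≡⟨ *-CS.xy∙z≈xz∙y (length ℓ) (length J) _ ⟩
  length ℓ * ∑ (λ s → #X s * #Y s) ℓ * length J
    ≡⟨ cong (_* length J) (length*∑-by-swapping _≟S_ ℓ unique #X #Y mix mix∈ #X-mix #Y-mix mix-involutive) ⟩
  ∑ #X ℓ * ∑ #Y ℓ * length J
    ≡⟨ ℕP.*-assoc (∑ #X ℓ) _ (length J) ⟩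
  ∑ #X ℓ * (∑ #Y ℓ * length J)
    ≡⟨ cong₂ _*_ (sym count-X) (sym count-Y) ⟩
  count (λ ω → does (X ω ≟A a)) Ω * count (λ ω → does (Y (proj₁ ω) ≟B b)) Ω ∎
  where
  open ≡-Reasoning
  Ω = cartesianProduct ℓ J
  #X #Y : S → ℕ
  #X s = ∑ (λ j → [ does (X (s , j) ≟A a) ]· 1) J
  #Y s = [ does (Y s ≟B b) ]· 1

  #X-mix : ∀ {s s′} → s ∈ ℓ → s′ ∈ ℓ → #X (mix s s′) ≡ #X s
  #X-mix s∈ s′∈ = ∑-cong J (λ {j} _ → cong (λ x → [ does (x ≟A a) ]· 1) (X-mix s∈ s′∈ j))

  #Y-mix : ∀ {s s′} → s ∈ ℓ → s′ ∈ ℓ → #Y (mix s s′) ≡ #Y s′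
  #Y-mix s∈ s′∈ = cong (λ y → [ does (y ≟B b) ]· 1) (Y-mix s∈ s′∈)

  length-Ω : length Ω ≡ length ℓ * length J
  length-Ω = trans (length≡∑ Ω) (trans (∑-cartesianProduct (λ _ → 1) ℓ J)
               (trans (∑-cong ℓ (λ _ → sym (length≡∑ J))) (∑-const (length J) ℓ)))

  count-X∧Y : count (λ ω → does (X ω ≟A a) ∧ does (Y (proj₁ ω) ≟B b)) Ω ≡ ∑ (λ s → #X s * #Y s) ℓ
  count-X∧Y = trans (count≡∑ _ Ω) (trans (∑-cartesianProduct _ ℓ J)
                (∑-cong ℓ (λ {s} _ → trans (∑-cong J (λ {j} _ → indicator-∧ (does (X (s , j) ≟A a)) (does (Y s ≟B b))))
                                           (∑-*ʳ (#Y s) _ J))))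

  count-X : count (λ ω → does (X ω ≟A a)) Ω ≡ ∑ #X ℓ
  count-X = trans (count≡∑ _ Ω) (∑-cartesianProduct _ ℓ J)

  count-Y : count (λ ω → does (Y (proj₁ ω) ≟B b)) Ω ≡ ∑ #Y ℓ * length J
  count-Y = trans (count≡∑ _ Ω) (trans (∑-cartesianProduct _ ℓ J)
              (trans (∑-cong ℓ (λ {s} _ → trans (∑-const _ J) (ℕP.*-comm (length J) _))) (∑-*ʳ (length J) _ ℓ)))

-- Integer and rational arithmetic

0≤+ : ∀ n → 0ℤ ℤ.≤ + n
0≤+ n = ℤ.+≤+ ℕ.z≤n

0≤i∧0≤j⇒0≤i*j : ∀ {i j} → 0ℤ ℤ.≤ i → 0ℤ ℤ.≤ j → 0ℤ ℤ.≤ i ℤ.* j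
0≤i∧0≤j⇒0≤i*j {i} {j} 0≤i 0≤j = subst (ℤ._≤ i ℤ.* j) (ℤP.*-zeroˡ j) (ℤP.*-monoʳ-≤-nonNeg j {{ℤ.nonNegative 0≤j}} 0≤i)

≤-by-difference : ∀ {i j} d → 0ℤ ℤ.≤ d → j ℤ.- i ≡ d → i ℤ.≤ j
≤-by-difference d 0≤d j-i≡d = ℤP.0≤i-j⇒j≤i (subst (0ℤ ℤ.≤_) (sym j-i≡d) 0≤d)

2i-1≤2j⇒i≤j : ∀ i j → + 2 ℤ.* i ℤ.- 1ℤ ℤ.≤ + 2 ℤ.* j → i ℤ.≤ j
2i-1≤2j⇒i≤j i j h with i ℤ.≤? j
... | yes i≤j = i≤j
... | no  i≰j with ℤP.≤-trans (ℤP.+-monoˡ-≤ 1ℤ (ℤP.+-mono-≤ (ℤP.i≤j⇒0≤j-i h) (ℤP.+-mono-≤ 0≤i-1-j 0≤i-1-j)))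
                              (ℤP.≤-reflexive (sum≡0 i j))
  where
  0≤i-1-j : 0ℤ ℤ.≤ i ℤ.- (1ℤ ℤ.+ j)
  0≤i-1-j = ℤP.i≤j⇒0≤j-i (ℤP.i<j⇒suc[i]≤j (ℤP.≰⇒> i≰j))
  sum≡0 : ∀ i j → + 2 ℤ.* j ℤ.- (+ 2 ℤ.* i ℤ.- 1ℤ) ℤ.+ (i ℤ.- (1ℤ ℤ.+ j) ℤ.+ (i ℤ.- (1ℤ ℤ.+ j))) ℤ.+ 1ℤ ≡ 0ℤ
  sum≡0 = solve-∀
... | ℤ.+≤+ ()

-- a / b ≤ c / d ≤ e / f implies a / b ≤ e / f, stated with the denominators multiplied out.
cross-≤-trans : ∀ a b c d e f → 0ℤ ℤ.≤ b → ℤ.Positive d → 0ℤ ℤ.≤ f →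
                a ℤ.* d ℤ.≤ c ℤ.* b → c ℤ.* f ℤ.≤ e ℤ.* d → a ℤ.* f ℤ.≤ e ℤ.* b
cross-≤-trans a b c d e f 0≤b d>0 0≤f ad≤cb cf≤ed = ℤP.*-cancelˡ-≤-pos (a ℤ.* f) (e ℤ.* b) d {{d>0}} (begin
  d ℤ.* (a ℤ.* f) ≡⟨ shuffle d a f ⟩
  (a ℤ.* d) ℤ.* f ≤⟨ ℤP.*-monoʳ-≤-nonNeg f {{ℤ.nonNegative 0≤f}} ad≤cb ⟩
  (c ℤ.* b) ℤ.* f ≡⟨ swap₂₃ c b f ⟩
  (c ℤ.* f) ℤ.* b ≤⟨ ℤP.*-monoʳ-≤-nonNeg b {{ℤ.nonNegative 0≤b}} cf≤ed ⟩
  (e ℤ.* d) ℤ.* b ≡⟨ sym (shuffle d e b) ⟩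
  d ℤ.* (e ℤ.* b) ∎)
  where
  open ℤP.≤-Reasoning
  shuffle : ∀ x y z → x ℤ.* (y ℤ.* z) ≡ (y ℤ.* x) ℤ.* z
  shuffle = solve-∀
  swap₂₃ : ∀ x y z → (x ℤ.* y) ℤ.* z ≡ (x ℤ.* z) ℤ.* y
  swap₂₃ = solve-∀

toℚᵘ-toℚ : ∀ i → ℚ.toℚᵘ (toℚ i) ℚᵘ.≃ mkℚᵘ i 0
toℚᵘ-toℚ i = ℚP.toℚᵘ-fromℚᵘ (mkℚᵘ i 0)

toℚ-+ : ∀ i j → toℚ (i ℤ.+ j) ≡ toℚ i ℚ.+ toℚ j
toℚ-+ i j = ℚP.toℚᵘ-injective (begin
  ℚ.toℚᵘ (toℚ (i ℤ.+ j))              ≈⟨ toℚᵘ-toℚ (i ℤ.+ j) ⟩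
  mkℚᵘ (i ℤ.+ j) 0                    ≈⟨ *≡* (cross i j) ⟩
  mkℚᵘ i 0 ℚᵘ.+ mkℚᵘ j 0              ≈⟨ ℚᵘP.+-cong (ℚᵘP.≃-sym (toℚᵘ-toℚ i)) (ℚᵘP.≃-sym (toℚᵘ-toℚ j)) ⟩
  ℚ.toℚᵘ (toℚ i) ℚᵘ.+ ℚ.toℚᵘ (toℚ j) ≈⟨ ℚᵘP.≃-sym (ℚP.toℚᵘ-homo-+ (toℚ i) (toℚ j)) ⟩
  ℚ.toℚᵘ (toℚ i ℚ.+ toℚ j)            ∎)
  where
  open ℚᵘP.≃-Reasoning
  cross : ∀ i j → (i ℤ.+ j) ℤ.* 1ℤ ≡ (i ℤ.* 1ℤ ℤ.+ j ℤ.* 1ℤ) ℤ.* 1ℤ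
  cross = solve-∀

toℚ-* : ∀ i j → toℚ (i ℤ.* j) ≡ toℚ i ℚ.* toℚ j
toℚ-* i j = ℚP.toℚᵘ-injective (begin
  ℚ.toℚᵘ (toℚ (i ℤ.* j))              ≈⟨ toℚᵘ-toℚ (i ℤ.* j) ⟩
  mkℚᵘ (i ℤ.* j) 0                    ≈⟨ ℚᵘP.≃-refl ⟩
  mkℚᵘ i 0 ℚᵘ.* mkℚᵘ j 0              ≈⟨ ℚᵘP.*-cong (ℚᵘP.≃-sym (toℚᵘ-toℚ i)) (ℚᵘP.≃-sym (toℚᵘ-toℚ j)) ⟩
  ℚ.toℚᵘ (toℚ i) ℚᵘ.* ℚ.toℚᵘ (toℚ j) ≈⟨ ℚᵘP.≃-sym (ℚP.toℚᵘ-homo-* (toℚ i) (toℚ j)) ⟩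
  ℚ.toℚᵘ (toℚ i ℚ.* toℚ j)            ∎)
  where open ℚᵘP.≃-Reasoning

toℚ-neg : ∀ i → toℚ (ℤ.- i) ≡ ℚ.- toℚ i
toℚ-neg i = ℚP.toℚᵘ-injective (begin
  ℚ.toℚᵘ (toℚ (ℤ.- i))  ≈⟨ toℚᵘ-toℚ (ℤ.- i) ⟩
  mkℚᵘ (ℤ.- i) 0        ≈⟨ ℚᵘP.-‿cong (ℚᵘP.≃-sym (toℚᵘ-toℚ i)) ⟩
  ℚᵘ.- ℚ.toℚᵘ (toℚ i)   ≈⟨ ℚᵘP.≃-sym (ℚP.toℚᵘ-homo‿- (toℚ i)) ⟩
  ℚ.toℚᵘ (ℚ.- toℚ i)    ∎)
  where open ℚᵘP.≃-Reasoning

toℚ-- : ∀ i j → toℚ (i ℤ.- j) ≡ toℚ i ℚ.- toℚ j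
toℚ-- i j = trans (toℚ-+ i (ℤ.- j)) (cong (toℚ i ℚ.+_) (toℚ-neg j))

toℚ-mono-≤ : ∀ {i j} → i ℤ.≤ j → toℚ i ℚ.≤ toℚ j
toℚ-mono-≤ {i} {j} i≤j = ℚP.toℚᵘ-cancel-≤
  (ℚᵘP.≤-respʳ-≃ (ℚᵘP.≃-sym (toℚᵘ-toℚ j)) (ℚᵘP.≤-respˡ-≃ (ℚᵘP.≃-sym (toℚᵘ-toℚ i))
    (*≤* (ℤP.*-monoʳ-≤-nonNeg 1ℤ i≤j))))

toℚ-cancel-≤ : ∀ {i j} → toℚ i ℚ.≤ toℚ j → i ℤ.≤ j
toℚ-cancel-≤ {i} {j} le with ℚᵘP.≤-respʳ-≃ (toℚᵘ-toℚ j) (ℚᵘP.≤-respˡ-≃ (toℚᵘ-toℚ i) (ℚP.toℚᵘ-mono-≤ le))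
... | *≤* i*1≤j*1 = subst₂ ℤ._≤_ (ℤP.*-identityʳ i) (ℤP.*-identityʳ j) i*1≤j*1

toℚ-nonNeg : ∀ {i} → 0ℤ ℤ.≤ i → ℚ.NonNegative (toℚ i)
toℚ-nonNeg 0≤i = ℚ.nonNegative (toℚ-mono-≤ 0≤i)

toℚ-pos : ∀ n → ℚ.Positive (toℚ (+ suc n))
toℚ-pos n = ℚ.positive (ℚP.toℚᵘ-cancel-<
  (ℚᵘP.<-respʳ-≃ (ℚᵘP.≃-sym (toℚᵘ-toℚ (+ suc n))) (ℚᵘP.<-respˡ-≃ (ℚᵘP.≃-sym (toℚᵘ-toℚ 0ℤ))
    (ℚᵘ.*<* (ℤ.+<+ (ℕ.s≤s ℕ.z≤n))))))

/-*-cancel : ∀ (i : ℤ) (n : ℕ) → (i ℚ./ suc n) ℚ.* toℚ (+ suc n) ≡ toℚ i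
/-*-cancel i n = ℚP.toℚᵘ-injective (begin
  ℚ.toℚᵘ ((i ℚ./ suc n) ℚ.* toℚ (+ suc n))          ≈⟨ ℚP.toℚᵘ-homo-* (i ℚ./ suc n) (toℚ (+ suc n)) ⟩
  ℚ.toℚᵘ (i ℚ./ suc n) ℚᵘ.* ℚ.toℚᵘ (toℚ (+ suc n)) ≈⟨ ℚᵘP.*-cong (ℚP.toℚᵘ-fromℚᵘ (mkℚᵘ i n)) (toℚᵘ-toℚ (+ suc n)) ⟩
  mkℚᵘ i n ℚᵘ.* mkℚᵘ (+ suc n) 0                    ≈⟨ *≡* (cancel i n) ⟩
  mkℚᵘ i 0                                          ≈⟨ ℚᵘP.≃-sym (toℚᵘ-toℚ i) ⟩
  ℚ.toℚᵘ (toℚ i)                                    ∎)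
  where
  open ℚᵘP.≃-Reasoning
  cancel : ∀ i n → (i ℤ.* + suc n) ℤ.* 1ℤ ≡ i ℤ.* + (suc n ℕ.* 1)
  cancel i n = trans (ℤP.*-identityʳ _) (cong (λ m → i ℤ.* + m) (sym (ℕP.*-identityʳ (suc n))))

neg-involutive : ∀ p → ℚ.- (ℚ.- p) ≡ p
neg-involutive = solve 1 (λ p → :- (:- p) := p) refl
  where open +-*-Solver

∣p∣≤q⇒-q≤p≤q : ∀ p q → ℚ.∣ p ∣ ℚ.≤ q → (ℚ.- q ℚ.≤ p) × (p ℚ.≤ q)
∣p∣≤q⇒-q≤p≤q p q ∣p∣≤q with ℚP.∣p∣≡p∨∣p∣≡-p p
... | inj₁ ∣p∣≡p  = ℚP.≤-trans (ℚP.neg-antimono-≤ 0≤q) (subst (0ℚ ℚ.≤_) ∣p∣≡p (ℚP.0≤∣p∣ p)) ,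
                    subst (ℚ._≤ q) ∣p∣≡p ∣p∣≤q
  where 0≤q = ℚP.≤-trans (ℚP.0≤∣p∣ p) ∣p∣≤q
... | inj₂ ∣p∣≡-p = subst (ℚ.- q ℚ.≤_) (neg-involutive p) (ℚP.neg-antimono-≤ (subst (ℚ._≤ q) ∣p∣≡-p ∣p∣≤q)) ,
                    ℚP.≤-trans p≤0 (ℚP.≤-trans (ℚP.0≤∣p∣ p) ∣p∣≤q)
  where
  p≤0 : p ℚ.≤ 0ℚ
  p≤0 = subst (ℚ._≤ 0ℚ) (trans (cong ℚ.-_ ∣p∣≡-p) (neg-involutive p)) (ℚP.neg-antimono-≤ (ℚP.0≤∣p∣ p))

-q≤p≤q⇒∣p∣≤q : ∀ p q → ℚ.- q ℚ.≤ p → p ℚ.≤ q → ℚ.∣ p ∣ ℚ.≤ q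
-q≤p≤q⇒∣p∣≤q p q -q≤p p≤q with ℚP.∣p∣≡p∨∣p∣≡-p p
... | inj₁ ∣p∣≡p  = subst (ℚ._≤ q) (sym ∣p∣≡p) p≤q
... | inj₂ ∣p∣≡-p = subst (ℚ._≤ q) (sym ∣p∣≡-p) (subst (ℚ.- p ℚ.≤_) (neg-involutive q) (ℚP.neg-antimono-≤ -q≤p))

toℚ-half : ∀ i → toℚ i ≡ ½ ℚ.* toℚ (+ 2 ℤ.* i)
toℚ-half i = begin
  toℚ i                          ≡⟨ sym (ℚP.*-identityˡ (toℚ i)) ⟩
  (½ ℚ.* toℚ (+ 2)) ℚ.* toℚ i    ≡⟨ ℚP.*-assoc ½ (toℚ (+ 2)) (toℚ i) ⟩
  ½ ℚ.* (toℚ (+ 2) ℚ.* toℚ i)    ≡⟨ cong (½ ℚ.*_) (sym (toℚ-* (+ 2) i)) ⟩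
  ½ ℚ.* toℚ (+ 2 ℤ.* i)          ∎
  where open ≡-Reasoning

segment-gap : ∀ U V W t → (toℚ U ℚ.+ t ℚ.* (toℚ V ℚ.- toℚ U)) ℚ.- toℚ W ≡ t ℚ.* toℚ (V ℤ.- U) ℚ.- toℚ (W ℤ.- U)
segment-gap U V W t = trans (shift (toℚ U) (toℚ V) (toℚ W) t) (sym (cong₂ (λ d e → t ℚ.* d ℚ.- e) (toℚ-- V U) (toℚ-- W U)))
  where
  shift : ∀ u v w t → (u ℚ.+ t ℚ.* (v ℚ.- u)) ℚ.- w ≡ t ℚ.* (v ℚ.- u) ℚ.- (w ℚ.- u)
  shift = solve 4 (λ u v w t → (u :+ t :* (v :- u)) :- w := t :* (v :- u) :- (w :- u)) refl
    where open +-*-Solver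

∣tD-E∣≤½⇒ : ∀ t D E → ℚ.∣ t ℚ.* toℚ D ℚ.- toℚ E ∣ ℚ.≤ ½ →
            (toℚ (+ 2 ℤ.* E ℤ.- 1ℤ) ℚ.≤ toℚ (+ 2) ℚ.* (t ℚ.* toℚ D)) ×
            (toℚ (+ 2) ℚ.* (t ℚ.* toℚ D) ℚ.≤ toℚ (+ 2 ℤ.* E ℤ.+ 1ℤ))
∣tD-E∣≤½⇒ t D E ∣x∣≤½ = (begin
    toℚ (+ 2 ℤ.* E ℤ.- 1ℤ)                 ≡⟨ toℚ-- (+ 2 ℤ.* E) 1ℤ ⟩
    toℚ (+ 2 ℤ.* E) ℚ.- toℚ 1ℤ             ≡⟨ cong (ℚ._- toℚ 1ℤ) (toℚ-* (+ 2) E) ⟩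
    two ℚ.* toℚ E ℚ.+ two ℚ.* ℚ.- ½         ≤⟨ ℚP.+-monoʳ-≤ (two ℚ.* toℚ E) (ℚP.*-monoˡ-≤-nonNeg two -½≤x) ⟩
    two ℚ.* toℚ E ℚ.+ two ℚ.* x             ≡⟨ split two t (toℚ D) (toℚ E) ⟩
    two ℚ.* (t ℚ.* toℚ D)                   ∎) ,
  (begin
    two ℚ.* (t ℚ.* toℚ D)                   ≡⟨ sym (split two t (toℚ D) (toℚ E)) ⟩
    two ℚ.* toℚ E ℚ.+ two ℚ.* x             ≤⟨ ℚP.+-monoʳ-≤ (two ℚ.* toℚ E) (ℚP.*-monoˡ-≤-nonNeg two x≤½) ⟩
    two ℚ.* toℚ E ℚ.+ two ℚ.* ½             ≡⟨ sym (cong₂ ℚ._+_ (toℚ-* (+ 2) E) refl) ⟩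
    toℚ (+ 2 ℤ.* E) ℚ.+ toℚ 1ℤ              ≡⟨ sym (toℚ-+ (+ 2 ℤ.* E) 1ℤ) ⟩
    toℚ (+ 2 ℤ.* E ℤ.+ 1ℤ)                 ∎)
  where
  open ℚP.≤-Reasoning
  two = toℚ (+ 2)
  x = t ℚ.* toℚ D ℚ.- toℚ E
  -½≤x = proj₁ (∣p∣≤q⇒-q≤p≤q x ½ ∣x∣≤½)
  x≤½ = proj₂ (∣p∣≤q⇒-q≤p≤q x ½ ∣x∣≤½)
  split : ∀ c t d e → c ℚ.* e ℚ.+ c ℚ.* (t ℚ.* d ℚ.- e) ≡ c ℚ.* (t ℚ.* d)
  split = solve 4 (λ c t d e → c :* e :+ c :* (t :* d :- e) := c :* (t :* d)) refl
    where open +-*-Solver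

fraction-gap : ∀ P q D E → (+ 2 ℤ.* E ℤ.- 1ℤ) ℤ.* + suc q ℤ.≤ P ℤ.* (+ 2 ℤ.* D) →
               P ℤ.* (+ 2 ℤ.* D) ℤ.≤ (+ 2 ℤ.* E ℤ.+ 1ℤ) ℤ.* + suc q →
               ℚ.∣ (P ℚ./ suc q) ℚ.* toℚ D ℚ.- toℚ E ∣ ℚ.≤ ½
fraction-gap P q D E lo hi = -q≤p≤q⇒∣p∣≤q x ½
  (ℚP.*-cancelʳ-≤-pos T {{toℚ-pos q}} (begin
    ℚ.- ½ ℚ.* T               ≡⟨ trans (sym (ℚP.neg-distribˡ-* ½ T)) (ℚP.neg-distribʳ-* ½ T) ⟩
    ½ ℚ.* ℚ.- T               ≡⟨ cong (½ ℚ.*_) (sym (toℚ-neg Q)) ⟩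
    ½ ℚ.* toℚ (ℤ.- Q)         ≤⟨ ℚP.*-monoˡ-≤-nonNeg ½ (toℚ-mono-≤ -Q≤2N) ⟩
    ½ ℚ.* toℚ (+ 2 ℤ.* N)     ≡⟨ sym x*T≡½*2N ⟩
    x ℚ.* T                   ∎))
  (ℚP.*-cancelʳ-≤-pos T {{toℚ-pos q}} (begin
    x ℚ.* T                   ≡⟨ x*T≡½*2N ⟩
    ½ ℚ.* toℚ (+ 2 ℤ.* N)     ≤⟨ ℚP.*-monoˡ-≤-nonNeg ½ (toℚ-mono-≤ 2N≤Q) ⟩
    ½ ℚ.* T                   ∎))
  where
  open ℚP.≤-Reasoning
  Q = + suc q
  T = toℚ Q
  t = P ℚ./ suc q
  x = t ℚ.* toℚ D ℚ.- toℚ E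
  N = P ℤ.* D ℤ.- E ℤ.* Q
  x*T≡½*2N : x ℚ.* T ≡ ½ ℚ.* toℚ (+ 2 ℤ.* N)
  x*T≡½*2N = begin-equality
    x ℚ.* T                                ≡⟨ distrib t (toℚ D) (toℚ E) T ⟩
    (t ℚ.* T) ℚ.* toℚ D ℚ.- toℚ E ℚ.* T     ≡⟨ cong (λ y → y ℚ.* toℚ D ℚ.- toℚ E ℚ.* T) (/-*-cancel P q) ⟩
    toℚ P ℚ.* toℚ D ℚ.- toℚ E ℚ.* T         ≡⟨ sym (cong₂ ℚ._-_ (toℚ-* P D) (toℚ-* E Q)) ⟩
    toℚ (P ℤ.* D) ℚ.- toℚ (E ℤ.* Q)         ≡⟨ sym (toℚ-- (P ℤ.* D) (E ℤ.* Q)) ⟩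
    toℚ N                                   ≡⟨ toℚ-half N ⟩
    ½ ℚ.* toℚ (+ 2 ℤ.* N)                   ∎
    where
    distrib : ∀ t d e T → (t ℚ.* d ℚ.- e) ℚ.* T ≡ (t ℚ.* T) ℚ.* d ℚ.- e ℚ.* T
    distrib = solve 4 (λ t d e T → (t :* d :- e) :* T := (t :* T) :* d :- e :* T) refl
      where open +-*-Solver
  2N≤Q : + 2 ℤ.* N ℤ.≤ Q
  2N≤Q = ≤-by-difference _ (ℤP.i≤j⇒0≤j-i hi) (gap P D E Q)
    where
    gap : ∀ P D E Q → Q ℤ.- + 2 ℤ.* (P ℤ.* D ℤ.- E ℤ.* Q) ≡ (+ 2 ℤ.* E ℤ.+ 1ℤ) ℤ.* Q ℤ.- P ℤ.* (+ 2 ℤ.* D)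
    gap = solve-∀
  -Q≤2N : ℤ.- Q ℤ.≤ + 2 ℤ.* N
  -Q≤2N = ≤-by-difference _ (ℤP.i≤j⇒0≤j-i lo) (gap P D E Q)
    where
    gap : ∀ P D E Q → + 2 ℤ.* (P ℤ.* D ℤ.- E ℤ.* Q) ℤ.- ℤ.- Q ≡ P ℤ.* (+ 2 ℤ.* D) ℤ.- (+ 2 ℤ.* E ℤ.- 1ℤ) ℤ.* Q
    gap = solve-∀

-- Unit cubes meeting a segment

module LeastBy {C : Set} (P : C → Set) (P? : Decidable P)
  (_⊑_ : C → C → Set) (_⊑?_ : ∀ x y → Dec (x ⊑ y))
  (⊑-total : ∀ {x y} → ¬ x ⊑ y → y ⊑ x)
  (⊑-trans : ∀ {x y z} → P x → P y → P z → x ⊑ y → y ⊑ z → x ⊑ z) where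

  data Least (cs : List C) : Set where
    none : All (λ c → ¬ P c) cs → Least cs
    some : (m : C) → P m → All (λ c → P c → m ⊑ c) cs → Least cs

  ⊑-refl : ∀ x → x ⊑ x
  ⊑-refl x with x ⊑? x
  ... | yes x⊑x = x⊑x
  ... | no  x⋢x = ⊑-total x⋢x

  least : (cs : List C) → Least cs
  least [] = none []
  least (c ∷ cs) with least cs | P? c
  ... | none ¬P      | no  ¬Pc = none (¬Pc ∷ ¬P)
  ... | none ¬P      | yes Pc  = some c Pc ((λ _ → ⊑-refl c) ∷ All.map (λ ¬Pc′ Pc′ → ⊥-elim (¬Pc′ Pc′)) ¬P)
  ... | some m Pm m⊑ | no  ¬Pc = some m Pm ((λ Pc → ⊥-elim (¬Pc Pc)) ∷ m⊑)
  ... | some m Pm m⊑ | yes Pc with m ⊑? c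
  ...   | yes m⊑c = some m Pm ((λ _ → m⊑c) ∷ m⊑)
  ...   | no  m⋢c = some c Pc ((λ _ → ⊑-refl c) ∷
                      All.map (λ m⊑c′ Pc′ → ⊑-trans Pc Pm Pc′ (⊑-total m⋢c) (m⊑c′ Pc′)) m⊑)

0<i⇒i≡+suc : ∀ {i} → 0ℤ ℤ.< i → Σ ℕ λ n → i ≡ + suc n
0<i⇒i≡+suc {+ zero}  (ℤ.+<+ ())
0<i⇒i≡+suc {+ suc n} _ = n , refl

ac≤bd⇒a[2c]≤b[2d] : ∀ a b c d → a ℤ.* c ℤ.≤ b ℤ.* d → a ℤ.* (+ 2 ℤ.* c) ℤ.≤ b ℤ.* (+ 2 ℤ.* d)
ac≤bd⇒a[2c]≤b[2d] a b c d ac≤bd = begin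
  a ℤ.* (+ 2 ℤ.* c) ≡⟨ assoc a c ⟩
  (a ℤ.* c) ℤ.* + 2 ≤⟨ ℤP.*-monoʳ-≤-nonNeg (+ 2) ac≤bd ⟩
  (b ℤ.* d) ℤ.* + 2 ≡⟨ sym (assoc b d) ⟩
  b ℤ.* (+ 2 ℤ.* d) ∎
  where
  open ℤP.≤-Reasoning
  assoc : ∀ x y → x ℤ.* (+ 2 ℤ.* y) ≡ (x ℤ.* y) ℤ.* + 2
  assoc = solve-∀

record _≼_ {k} (x y : Point k) : Set where
  constructor coordinatewise
  field ≤-at : ∀ c → lookup x c ℤ.≤ lookup y c

open _≼_ public

module CubeCriterion {k : ℕ} (u v : Point k) where

  D : Fin k → ℤ
  D c = lookup v c ℤ.- lookup u c

  E : Point k → Fin k → ℤ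
  E w c = lookup w c ℤ.- lookup u c

  lo hi : Point k → Fin k → ℤ
  lo w c = + 2 ℤ.* E w c ℤ.- 1ℤ
  hi w c = + 2 ℤ.* E w c ℤ.+ 1ℤ

  -- On coordinate c the admissible t form the interval [lo / 2D , hi / 2D] (all of ℚ if D = E = 0);
  -- by integrality some t ∈ [0, 1] is admissible iff 0 ≤ E ≤ D, and a common t exists iff the
  -- intervals pairwise overlap.
  InBox : Point k → Set
  InBox w = ∀ c → (0ℤ ℤ.≤ E w c) × (E w c ℤ.≤ D c)

  IntervalsMeet : Point k → Set
  IntervalsMeet w = ∀ c c′ → lo w c ℤ.* D c′ ℤ.≤ hi w c′ ℤ.* D c

  Criterion : Point k → Set
  Criterion w = InBox w × IntervalsMeet w

  criterion? : ∀ w → Dec (Criterion w)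
  criterion? w = FinP.all? (λ c → (0ℤ ℤ.≤? E w c) ×-dec (E w c ℤ.≤? D c)) ×-dec
                 FinP.all? (λ c → FinP.all? (λ c′ → lo w c ℤ.* D c′ ℤ.≤? hi w c′ ℤ.* D c))

  gap-at : ∀ w t c → (toℚ (lookup u c) ℚ.+ t ℚ.* (toℚ (lookup v c) ℚ.- toℚ (lookup u c))) ℚ.- toℚ (lookup w c)
                     ≡ t ℚ.* toℚ (D c) ℚ.- toℚ (E w c)
  gap-at w t c = segment-gap (lookup u c) (lookup v c) (lookup w c) t

  cube⇒criterion : u ≼ v → ∀ w → CubeMeetsSegment w u v → Criterion w
  cube⇒criterion u≼v w (t , 0≤t , t≤1 , near) = box , meet
    where
    two = toℚ (+ 2)
    0≤D : ∀ c → 0ℤ ℤ.≤ D c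
    0≤D c = ℤP.i≤j⇒0≤j-i (≤-at u≼v c)
    bounds : ∀ c → (toℚ (lo w c) ℚ.≤ two ℚ.* (t ℚ.* toℚ (D c))) × (two ℚ.* (t ℚ.* toℚ (D c)) ℚ.≤ toℚ (hi w c))
    bounds c = ∣tD-E∣≤½⇒ t (D c) (E w c) (subst (λ x → ℚ.∣ x ∣ ℚ.≤ ½) (gap-at w t c) (near c))
    box : InBox w
    box c = 2i-1≤2j⇒i≤j 0ℤ (E w c) (≤-by-difference _ 0≤hi (shift (E w c))) ,
            2i-1≤2j⇒i≤j (E w c) (D c) (toℚ-cancel-≤ (ℚP.≤-trans (proj₁ (bounds c)) 2tD≤2D))
      where
      0≤hi : 0ℤ ℤ.≤ hi w c
      0≤hi = toℚ-cancel-≤ (ℚP.≤-trans (ℚP.nonNegative⁻¹ _ {{ℚP.nonNeg*nonNeg⇒nonNeg two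
               (t ℚ.* toℚ (D c)) {{ℚP.nonNeg*nonNeg⇒nonNeg t {{ℚ.nonNegative 0≤t}} (toℚ (D c)) {{toℚ-nonNeg (0≤D c)}}}}}})
               (proj₂ (bounds c)))
      shift : ∀ e → + 2 ℤ.* e ℤ.- (+ 2 ℤ.* 0ℤ ℤ.- 1ℤ) ≡ + 2 ℤ.* e ℤ.+ 1ℤ
      shift = solve-∀
      2tD≤2D : two ℚ.* (t ℚ.* toℚ (D c)) ℚ.≤ toℚ (+ 2 ℤ.* D c)
      2tD≤2D = begin
        two ℚ.* (t ℚ.* toℚ (D c))
          ≤⟨ ℚP.*-monoˡ-≤-nonNeg two (ℚP.*-monoʳ-≤-nonNeg (toℚ (D c)) {{toℚ-nonNeg (0≤D c)}} t≤1) ⟩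
        two ℚ.* (1ℚ ℚ.* toℚ (D c))   ≡⟨ cong (two ℚ.*_) (ℚP.*-identityˡ (toℚ (D c))) ⟩
        two ℚ.* toℚ (D c)            ≡⟨ sym (toℚ-* (+ 2) (D c)) ⟩
        toℚ (+ 2 ℤ.* D c)            ∎
        where open ℚP.≤-Reasoning
    meet : IntervalsMeet w
    meet c c′ = toℚ-cancel-≤ (begin
      toℚ (lo w c ℤ.* D c′)                          ≡⟨ toℚ-* (lo w c) (D c′) ⟩
      toℚ (lo w c) ℚ.* toℚ (D c′)
        ≤⟨ ℚP.*-monoʳ-≤-nonNeg (toℚ (D c′)) {{toℚ-nonNeg (0≤D c′)}} (proj₁ (bounds c)) ⟩
      (two ℚ.* (t ℚ.* toℚ (D c))) ℚ.* toℚ (D c′)     ≡⟨ exchange two t (toℚ (D c)) (toℚ (D c′)) ⟩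
      (two ℚ.* (t ℚ.* toℚ (D c′))) ℚ.* toℚ (D c)
        ≤⟨ ℚP.*-monoʳ-≤-nonNeg (toℚ (D c)) {{toℚ-nonNeg (0≤D c)}} (proj₂ (bounds c′)) ⟩
      toℚ (hi w c′) ℚ.* toℚ (D c)                    ≡⟨ sym (toℚ-* (hi w c′) (D c)) ⟩
      toℚ (hi w c′ ℤ.* D c)                          ∎)
      where
      open ℚP.≤-Reasoning
      exchange : ∀ a t d d′ → (a ℚ.* (t ℚ.* d)) ℚ.* d′ ≡ (a ℚ.* (t ℚ.* d′)) ℚ.* d
      exchange = solve 4 (λ a t d d′ → (a :* (t :* d)) :* d′ := (a :* (t :* d′)) :* d) refl
        where open +-*-Solver

  cube-at : ∀ w P q → 0ℤ ℤ.≤ P → P ℤ.≤ + suc q →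
            (∀ c → (lo w c ℤ.* + suc q ℤ.≤ P ℤ.* (+ 2 ℤ.* D c)) × (P ℤ.* (+ 2 ℤ.* D c) ℤ.≤ hi w c ℤ.* + suc q)) →
            CubeMeetsSegment w u v
  cube-at w P q 0≤P P≤Q bounds = P ℚ./ suc q , 0≤t , t≤1 ,
    λ c → subst (λ x → ℚ.∣ x ∣ ℚ.≤ ½) (sym (gap-at w (P ℚ./ suc q) c))
                (fraction-gap P q (D c) (E w c) (proj₁ (bounds c)) (proj₂ (bounds c)))
    where
    open ℚP.≤-Reasoning
    T = toℚ (+ suc q)
    0≤t = ℚP.*-cancelʳ-≤-pos T {{toℚ-pos q}} (begin
      0ℚ ℚ.* T            ≡⟨ ℚP.*-zeroˡ T ⟩
      toℚ 0ℤ              ≤⟨ toℚ-mono-≤ 0≤P ⟩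
      toℚ P               ≡⟨ sym (/-*-cancel P q) ⟩
      (P ℚ./ suc q) ℚ.* T ∎)
    t≤1 = ℚP.*-cancelʳ-≤-pos T {{toℚ-pos q}} (begin
      (P ℚ./ suc q) ℚ.* T ≡⟨ /-*-cancel P q ⟩
      toℚ P               ≤⟨ toℚ-mono-≤ P≤Q ⟩
      T                   ≡⟨ sym (ℚP.*-identityˡ T) ⟩
      1ℚ ℚ.* T            ∎)

  cube-at-start : ∀ w → (∀ c → E w c ≡ 0ℤ) → CubeMeetsSegment w u v
  cube-at-start w E≡0 = cube-at w 0ℤ 0 ℤP.≤-refl (0≤+ 1) λ c →
    subst (λ e → (+ 2 ℤ.* e ℤ.- 1ℤ) ℤ.* 1ℤ ℤ.≤ 0ℤ ℤ.* (+ 2 ℤ.* D c)) (sym (E≡0 c))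
      (subst (-[1+ 0 ] ℤ.≤_) (sym (ℤP.*-zeroˡ (+ 2 ℤ.* D c))) ℤ.-≤+) ,
    subst (λ e → 0ℤ ℤ.* (+ 2 ℤ.* D c) ℤ.≤ (+ 2 ℤ.* e ℤ.+ 1ℤ) ℤ.* 1ℤ) (sym (E≡0 c))
      (subst (ℤ._≤ 1ℤ) (sym (ℤP.*-zeroˡ (+ 2 ℤ.* D c))) (0≤+ 1))

  -- Conversely t = max (0 , max_{D c > 0} lo c / 2 D c) is a common point.
  module _ (w : Point k) (box : InBox w) (meet : IntervalsMeet w) where

    private
      0≤D : ∀ c → 0ℤ ℤ.≤ D c
      0≤D c = ℤP.≤-trans (proj₁ (box c)) (proj₂ (box c))

      lower-end-trans : ∀ {x y z} → 0ℤ ℤ.< D x → 0ℤ ℤ.< D y → 0ℤ ℤ.< D z →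
                        lo w y ℤ.* D x ℤ.≤ lo w x ℤ.* D y → lo w z ℤ.* D y ℤ.≤ lo w y ℤ.* D z →
                        lo w z ℤ.* D x ℤ.≤ lo w x ℤ.* D z
      lower-end-trans {x} {y} {z} Dx>0 Dy>0 Dz>0 x⊑y y⊑z =
        cross-≤-trans (lo w z) (D z) (lo w y) (D y) (lo w x) (D x) (ℤP.<⇒≤ Dz>0) (ℤ.positive Dy>0) (ℤP.<⇒≤ Dx>0) y⊑z x⊑y

    -- c ⊑ c′ when the lower end of the t-interval of c is at least that of c′
    private
      module Latest = LeastBy (λ c → 0ℤ ℤ.< D c) (λ c → 0ℤ ℤ.<? D c)
        (λ c c′ → lo w c′ ℤ.* D c ℤ.≤ lo w c ℤ.* D c′) (λ c c′ → lo w c′ ℤ.* D c ℤ.≤? lo w c ℤ.* D c′)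
        (λ ≰ → ℤP.<⇒≤ (ℤP.≰⇒> ≰)) lower-end-trans

    latest-everywhere : ∀ {m} → All (λ c → 0ℤ ℤ.< D c → lo w c ℤ.* D m ℤ.≤ lo w m ℤ.* D c) (allFin k) →
                        ∀ c → lo w c ℤ.* D m ℤ.≤ lo w m ℤ.* D c
    latest-everywhere {m} latest c with 0ℤ ℤ.<? D c
    ... | yes Dc>0 = All.lookup latest (∈-allFin c) Dc>0
    ... | no  Dc≯0 = ℤP.≤-trans (meet c m)
                       (≤-by-difference _ (ℤP.*-monoˡ-≤-nonNeg (+ 2) (ℤP.neg-mono-≤ (ℤP.≮⇒≥ Dc≯0))) (narrower (E w m) (D c)))
      where
      narrower : ∀ e d → (+ 2 ℤ.* e ℤ.- 1ℤ) ℤ.* d ℤ.- (+ 2 ℤ.* e ℤ.+ 1ℤ) ℤ.* d ≡ + 2 ℤ.* ℤ.- d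
      narrower = solve-∀

    flat⇒cube : (∀ c → D c ℤ.≤ 0ℤ) → CubeMeetsSegment w u v
    flat⇒cube D≤0 = cube-at-start w (λ c → ℤP.≤-antisym (ℤP.≤-trans (proj₂ (box c)) (D≤0 c)) (proj₁ (box c)))

    latest-at-start⇒cube : ∀ m → 0ℤ ℤ.< D m → (∀ c → lo w c ℤ.* D m ℤ.≤ lo w m ℤ.* D c) → E w m ℤ.≤ 0ℤ →
                           CubeMeetsSegment w u v
    latest-at-start⇒cube m Dm>0 latest Em≤0 = cube-at-start w (λ c → ℤP.≤-antisym (E≤0 c) (proj₁ (box c)))
      where
      lo-m≤0 : lo w m ℤ.≤ 0ℤ
      lo-m≤0 = ≤-by-difference _ (ℤP.+-mono-≤ (ℤP.*-monoˡ-≤-nonNeg (+ 2) (ℤP.neg-mono-≤ Em≤0)) (0≤+ 1)) (flip (E w m))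
        where
        flip : ∀ e → 0ℤ ℤ.- (+ 2 ℤ.* e ℤ.- 1ℤ) ≡ + 2 ℤ.* ℤ.- e ℤ.+ 1ℤ
        flip = solve-∀
      E≤0 : ∀ c → E w c ℤ.≤ 0ℤ
      E≤0 c = 2i-1≤2j⇒i≤j (E w c) 0ℤ (ℤP.*-cancelʳ-≤-pos (lo w c) 0ℤ (D m) {{ℤ.positive Dm>0}} (begin
        lo w c ℤ.* D m ≤⟨ latest c ⟩
        lo w m ℤ.* D c ≤⟨ ℤP.*-monoʳ-≤-nonNeg (D c) {{ℤ.nonNegative (0≤D c)}} lo-m≤0 ⟩
        0ℤ ℤ.* D c     ≡⟨ ℤP.*-zeroˡ (D c) ⟩
        0ℤ             ≡⟨ sym (ℤP.*-zeroˡ (D m)) ⟩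
        0ℤ ℤ.* D m     ∎))
        where open ℤP.≤-Reasoning

    latest-inside⇒cube : ∀ m d → D m ≡ + suc d → (∀ c → lo w c ℤ.* D m ℤ.≤ lo w m ℤ.* D c) → 1ℤ ℤ.≤ E w m →
                         CubeMeetsSegment w u v
    latest-inside⇒cube m d Dm≡ latest 1≤Em = cube-at w (lo w m) (d ℕ.+ suc (d ℕ.+ 0)) 0≤lo-m lo-m≤2Dm λ c →
      subst (λ Q → lo w c ℤ.* Q ℤ.≤ lo w m ℤ.* (+ 2 ℤ.* D c)) 2Dm≡
            (ac≤bd⇒a[2c]≤b[2d] (lo w c) (lo w m) (D m) (D c) (latest c)) ,
      subst (λ Q → lo w m ℤ.* (+ 2 ℤ.* D c) ℤ.≤ hi w c ℤ.* Q) 2Dm≡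
            (ac≤bd⇒a[2c]≤b[2d] (lo w m) (hi w c) (D c) (D m) (meet m c))
      where
      2Dm≡ : + 2 ℤ.* D m ≡ + suc (d ℕ.+ suc (d ℕ.+ 0))
      2Dm≡ = cong (+ 2 ℤ.*_) Dm≡
      0≤lo-m : 0ℤ ℤ.≤ lo w m
      0≤lo-m = ≤-by-difference _ (ℤP.+-mono-≤ (ℤP.*-monoˡ-≤-nonNeg (+ 2) (ℤP.i≤j⇒0≤j-i 1≤Em)) (0≤+ 1)) (shift (E w m))
        where
        shift : ∀ e → (+ 2 ℤ.* e ℤ.- 1ℤ) ℤ.- 0ℤ ≡ + 2 ℤ.* (e ℤ.- 1ℤ) ℤ.+ 1ℤ
        shift = solve-∀
      lo-m≤2Dm : lo w m ℤ.≤ + suc (d ℕ.+ suc (d ℕ.+ 0))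
      lo-m≤2Dm = subst (lo w m ℤ.≤_) 2Dm≡
                   (ℤP.≤-trans (ℤP.i-j≤i (+ 2 ℤ.* E w m) 1ℤ) (ℤP.*-monoˡ-≤-nonNeg (+ 2) (proj₂ (box m))))

    box∧meet⇒cube : CubeMeetsSegment w u v
    box∧meet⇒cube = from-least (Latest.least (allFin k))
      where
      from-least : Latest.Least (allFin k) → CubeMeetsSegment w u v
      from-least (Latest.none D≯0)          = flat⇒cube (λ c → ℤP.≮⇒≥ (All.lookup D≯0 (∈-allFin c)))
      from-least (Latest.some m Dm>0 latest) with E w m ℤ.≤? 0ℤ
      ... | yes Em≤0 = latest-at-start⇒cube m Dm>0 (latest-everywhere latest) Em≤0
      ... | no  Em≰0 = latest-inside⇒cube m (proj₁ (0<i⇒i≡+suc Dm>0)) (proj₂ (0<i⇒i≡+suc Dm>0))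
                         (latest-everywhere latest) (ℤP.i<j⇒suc[i]≤j (ℤP.≰⇒> Em≰0))

  criterion⇒cube : ∀ w → Criterion w → CubeMeetsSegment w u v
  criterion⇒cube w (box , meet) = box∧meet⇒cube w box meet

  cubeMeetsSegment? : u ≼ v → ∀ w → Dec (CubeMeetsSegment w u v)
  cubeMeetsSegment? u≼v w = map′ (criterion⇒cube w) (cube⇒criterion u≼v w) (criterion? w)

-- Lexicographically least admissible paths

module _ {A : Set} {_<_ : A → A → Set} (sto : IsStrictTotalOrder _≡_ _<_) where

  private module O = IsStrictTotalOrder sto

  Lex<-irrefl : ∀ {m} {xs : Vec A m} → ¬ Lex< _<_ xs xs
  Lex<-irrefl {xs = x ∷ xs} (inj₁ x<x)      = O.irrefl refl x<x
  Lex<-irrefl {xs = x ∷ xs} (inj₂ (_ , lt)) = Lex<-irrefl lt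

  Lex<-trans : ∀ {m} {xs ys zs : Vec A m} → Lex< _<_ xs ys → Lex< _<_ ys zs → Lex< _<_ xs zs
  Lex<-trans {xs = []}    {[]}    {[]}    ()
  Lex<-trans {xs = _ ∷ _} {_ ∷ _} {_ ∷ _} (inj₁ x<y)         (inj₁ y<z)         = inj₁ (O.trans x<y y<z)
  Lex<-trans {xs = _ ∷ _} {_ ∷ _} {_ ∷ _} (inj₁ x<y)         (inj₂ (refl , _))  = inj₁ x<y
  Lex<-trans {xs = _ ∷ _} {_ ∷ _} {_ ∷ _} (inj₂ (refl , _))  (inj₁ y<z)         = inj₁ y<z
  Lex<-trans {xs = _ ∷ _} {_ ∷ _} {_ ∷ _} (inj₂ (refl , lt)) (inj₂ (refl , lt′)) = inj₂ (refl , Lex<-trans lt lt′)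

  Lex<-compare : ∀ {m} → Trichotomous _≡_ (Lex< _<_ {m})
  Lex<-compare [] [] = tri≈ (λ ()) refl (λ ())
  Lex<-compare (x ∷ xs) (y ∷ ys) with O.compare x y
  ... | tri< x<y x≢y y≮x = tri< (inj₁ x<y) (x≢y ∘ VecP.∷-injectiveˡ)
                                (λ { (inj₁ y<x) → y≮x y<x ; (inj₂ (y≡x , _)) → x≢y (sym y≡x) })
  ... | tri> x≮y x≢y y<x = tri> (λ { (inj₁ x<y) → x≮y x<y ; (inj₂ (x≡y , _)) → x≢y x≡y })
                                (x≢y ∘ VecP.∷-injectiveˡ) (inj₁ y<x)
  ... | tri≈ x≮y refl y≮x with Lex<-compare xs ys
  ...   | tri< lt ne gt′ = tri< (inj₂ (refl , lt)) (ne ∘ VecP.∷-injectiveʳ)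
                                (λ { (inj₁ y<x) → y≮x y<x ; (inj₂ (_ , gt)) → gt′ gt })
  ...   | tri≈ lt′ refl gt′ = tri≈ (λ { (inj₁ x<y) → x≮y x<y ; (inj₂ (_ , lt)) → lt′ lt }) refl
                                   (λ { (inj₁ y<x) → y≮x y<x ; (inj₂ (_ , gt)) → gt′ gt })
  ...   | tri> lt′ ne gt = tri> (λ { (inj₁ x<y) → x≮y x<y ; (inj₂ (_ , lt)) → lt′ lt })
                                (ne ∘ VecP.∷-injectiveʳ) (inj₂ (refl , gt))

  Lex<-isStrictTotalOrder : ∀ {m} → IsStrictTotalOrder _≡_ (Lex< _<_ {m})
  Lex<-isStrictTotalOrder = record
    { isStrictPartialOrder = record
      { isEquivalence = isEquivalence
      ; irrefl        = λ { refl → Lex<-irrefl }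
      ; trans         = Lex<-trans
      ; <-resp-≈      = (λ { refl lt → lt }) , (λ { refl lt → lt })
      }
    ; compare = Lex<-compare
    }

<ᴸ-isStrictTotalOrder : ∀ {k m} → IsStrictTotalOrder _≡_ (_<ᴸ_ {k} {m})
<ᴸ-isStrictTotalOrder = Lex<-isStrictTotalOrder (Lex<-isStrictTotalOrder ℤP.<-isStrictTotalOrder)

lookup-⊕-unitVec : ∀ {k} (x : Point k) (c d : Fin k) →
                   lookup (x ⊕ unitVec c) d ≡ lookup x d ℤ.+ (if ⌊ c FinP.≟ d ⌋ then 1ℤ else 0ℤ)
lookup-⊕-unitVec x c d =
  trans (VecP.lookup-zipWith ℤ._+_ d x (unitVec c)) (cong (λ e → lookup x d ℤ.+ e) (VecP.lookup∘tabulate _ d))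

lookup-⊕-unitVec-≡ : ∀ {k} (x : Point k) c → lookup (x ⊕ unitVec c) c ≡ lookup x c ℤ.+ 1ℤ
lookup-⊕-unitVec-≡ x c =
  trans (lookup-⊕-unitVec x c c)
        (cong (λ b → lookup x c ℤ.+ (if b then 1ℤ else 0ℤ)) (trans (isYes≗does (c FinP.≟ c)) (dec-true (c FinP.≟ c) refl)))

lookup-⊕-unitVec-≢ : ∀ {k} (x : Point k) {c d} → c ≢ d → lookup (x ⊕ unitVec c) d ≡ lookup x d
lookup-⊕-unitVec-≢ x {c} {d} c≢d =
  trans (lookup-⊕-unitVec x c d)
        (trans (cong (λ b → lookup x d ℤ.+ (if b then 1ℤ else 0ℤ)) (trans (isYes≗does (c FinP.≟ d)) (dec-false (c FinP.≟ d) c≢d)))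
               (ℤP.+-identityʳ (lookup x d)))

≼-refl : ∀ {k} {x : Point k} → x ≼ x
≼-refl = coordinatewise (λ _ → ℤP.≤-refl)

≼-trans : ∀ {k} {x y z : Point k} → x ≼ y → y ≼ z → x ≼ z
≼-trans x≼y y≼z = coordinatewise (λ c → ℤP.≤-trans (≤-at x≼y c) (≤-at y≼z c))

_≼?_ : ∀ {k} (x y : Point k) → Dec (x ≼ y)
x ≼? y = map′ coordinatewise ≤-at (FinP.all? (λ c → lookup x c ℤ.≤? lookup y c))

step⇒≼ : ∀ {k} {x y : Point k} → Step x y → x ≼ y
step⇒≼ {x = x} (c , refl) = coordinatewise ≤-step
  where
  ≤-step : ∀ d → lookup x d ℤ.≤ lookup (x ⊕ unitVec c) d
  ≤-step d with c FinP.≟ d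
  ... | yes refl = ℤP.≤-trans (ℤP.i≤i+j (lookup x c) 1ℤ) (ℤP.≤-reflexive (sym (lookup-⊕-unitVec-≡ x c)))
  ... | no  c≢d  = ℤP.≤-reflexive (sym (lookup-⊕-unitVec-≢ x c≢d))

monotone⇒head≼last : ∀ {k m} (p : Vec (Point k) (suc m)) → MonotonePath p → head p ≼ last p
monotone⇒head≼last (x ∷ [])    _    = ≼-refl
monotone⇒head≼last (x ∷ y ∷ p) mono =
  ≼-trans (step⇒≼ (mono Fin.zero)) (monotone⇒head≼last (y ∷ p) (λ t → mono (Fin.suc t)))

module _ {k : ℕ} where

  walk : ∀ {m} → Point k → Vec (Fin k) m → Vec (Point k) (suc m)
  walk u []       = u ∷ []
  walk u (c ∷ cs) = u ∷ walk (u ⊕ unitVec c) cs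

  directions : (m : ℕ) → List (Vec (Fin k) m)
  directions zero    = [] ∷ []
  directions (suc m) = cartesianProductWith _∷_ (allFin k) (directions m)

  ∈-directions : ∀ {m} (cs : Vec (Fin k) m) → cs ∈ directions m
  ∈-directions []       = here refl
  ∈-directions (c ∷ cs) = ∈-cartesianProductWith⁺ _∷_ (∈-allFin c) (∈-directions cs)

  monotone⇒walk : ∀ {m} (p : Vec (Point k) (suc m)) → MonotonePath p → ∃ λ cs → p ≡ walk (head p) cs
  monotone⇒walk (x ∷ [])    _    = [] , refl
  monotone⇒walk (x ∷ y ∷ p) mono with mono Fin.zero | monotone⇒walk (y ∷ p) (λ t → mono (Fin.suc t))
  ... | c , refl | cs , p≡ = c ∷ cs , cong (x ∷_) p≡

  monotonePaths : ∀ m → Point k → List (Vec (Point k) (suc m))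
  monotonePaths m u = map (walk u) (directions m)

  ∈-monotonePaths : ∀ {m} (p : Vec (Point k) (suc m)) → MonotonePath p → p ∈ monotonePaths m (head p)
  ∈-monotonePaths p mono with monotone⇒walk p mono
  ... | cs , p≡ = subst (_∈ monotonePaths _ (head p)) (sym p≡) (∈-map⁺ (walk (head p)) (∈-directions cs))

  head-∈-monotonePaths : ∀ {m u p} → p ∈ monotonePaths m u → head p ≡ u
  head-∈-monotonePaths {u = u} p∈ with ∈-map⁻ (walk u) p∈
  ... | []    , _ , refl = refl
  ... | _ ∷ _ , _ , refl = refl

  step? : (x y : Point k) → Dec (Step x y)
  step? x y = FinP.any? (λ c → y ≟ᵖ (x ⊕ unitVec c))

  monotonePath? : ∀ {m} (p : Vec (Point k) (suc m)) → Dec (MonotonePath p)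
  monotonePath? p = FinP.all? (λ t → step? (lookup p (Fin.inject₁ t)) (lookup p (Fin.suc t)))

  admissible⇒≼ : ∀ {ρ} {u v : Point k} {p} → Admissible ρ u v p → u ≼ v
  admissible⇒≼ {p = p} (refl , refl , mono , _) = monotone⇒head≼last p mono

  admissible? : ∀ ρ (u v : Point k) p → Dec (Admissible ρ u v p)
  admissible? ρ u v p with u ≼? v
  ... | yes u≼v = (head p ≟ᵖ u) ×-dec (last p ≟ᵖ v) ×-dec monotonePath? p ×-dec
                  FinP.all? (λ t → CubeCriterion.cubeMeetsSegment? u v u≼v (lookup p t))
  ... | no  u⋠v = no (u⋠v ∘ admissible⇒≼)

pathOrder : ∀ k m → StrictTotalOrder _ _ _
pathOrder k m = record { isStrictTotalOrder = <ᴸ-isStrictTotalOrder {k} {m} }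

module _ {k : ℕ} (ρ : ℕ) where

  private
    Path = Vec (Point k) (suc ρ)
    module STO = IsStrictTotalOrder (<ᴸ-isStrictTotalOrder {k} {suc ρ})
    open import Data.List.Extrema (DecTotalOrder.totalOrder (StrictTotalOrderProperties.decTotalOrder (pathOrder k (suc ρ))))
      using (argmin; argmin-sel; f[argmin]≤f[⊤]; f[argmin]≤f[xs])

  _≤ᴸ_ : Path → Path → Set
  p ≤ᴸ q = (p ≡ q) ⊎ (p <ᴸ q)

  minimumOr : Path → List Path → Path
  minimumOr d []       = d
  minimumOr d (p ∷ ps) = argmin id p ps

  minimumOr-sel : ∀ d ps → (minimumOr d ps ≡ d) ⊎ (minimumOr d ps ∈ ps)
  minimumOr-sel d []       = inj₁ refl
  minimumOr-sel d (p ∷ ps) = inj₂ (Sum.[ here , there ]′ (argmin-sel id p ps))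

  minimumOr-∈ : ∀ d {q} ps → q ∈ ps → minimumOr d ps ∈ ps
  minimumOr-∈ d (p ∷ ps) _ = Sum.[ here , there ]′ (argmin-sel id p ps)

  minimumOr-≤ : ∀ d {q} ps → q ∈ ps → minimumOr d ps ≤ᴸ q
  minimumOr-≤ d (p ∷ ps) (here refl) = Sum.swap (f[argmin]≤f[⊤] {f = id} p ps)
  minimumOr-≤ d (p ∷ ps) (there q∈) = Sum.swap (All.lookup (f[argmin]≤f[xs] {f = id} p ps) q∈)

  ≤ᴸ-antisym : ∀ {p q} → p ≤ᴸ q → q ≤ᴸ p → p ≡ q
  ≤ᴸ-antisym (inj₁ p≡q) _           = p≡q
  ≤ᴸ-antisym (inj₂ p<q) (inj₁ q≡p)  = sym q≡p
  ≤ᴸ-antisym (inj₂ p<q) (inj₂ q<p)  = ⊥-elim (STO.irrefl refl (STO.trans p<q q<p))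

  -- replicate (suc ρ) u is a junk value, returned only when no admissible path exists.
  lexMinPath : Point k → Point k → Path
  lexMinPath u v = minimumOr (replicate (suc ρ) u) (filter (admissible? ρ u v) (monotonePaths ρ u))

  lexMinPath-lexMin : ∀ {u v q} → Admissible ρ u v q → LexMinAdmissible ρ u v (lexMinPath u v)
  lexMinPath-lexMin {u} {v} {q} adm =
    proj₂ (∈-filter⁻ (admissible? ρ u v) {xs = monotonePaths ρ u} (minimumOr-∈ _ candidates (∈-candidates adm))) ,
    λ q′ adm′ → minimumOr-≤ _ candidates (∈-candidates adm′)
    where
    candidates = filter (admissible? ρ u v) (monotonePaths ρ u)
    ∈-candidates : ∀ {q} → Admissible ρ u v q → q ∈ candidates
    ∈-candidates {q} adm@(refl , _ , mono , _) = ∈-filter⁺ (admissible? ρ u v) (∈-monotonePaths q mono) adm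

  head-lexMinPath : ∀ u v → head (lexMinPath u v) ≡ u
  head-lexMinPath u v with minimumOr-sel (replicate (suc ρ) u) (filter (admissible? ρ u v) (monotonePaths ρ u))
  ... | inj₁ ≡default = cong head ≡default
  ... | inj₂ ∈filter  = head-∈-monotonePaths (proj₁ (∈-filter⁻ (admissible? ρ u v) {xs = monotonePaths ρ u} ∈filter))

  lexMin-unique : ∀ {u v p q} → LexMinAdmissible ρ u v p → LexMinAdmissible ρ u v q → p ≡ q
  lexMin-unique (adm-p , min-p) (adm-q , min-q) = ≤ᴸ-antisym (min-p _ adm-q) (min-q _ adm-p)

-- Weights and the greedy path

wt-⊕ : ∀ {k} (x y : Point k) → wt (x ⊕ y) ≡ wt x ℤ.+ wt y
wt-⊕ []      []      = refl
wt-⊕ (a ∷ x) (b ∷ y) = trans (cong (λ z → a ℤ.+ b ℤ.+ z) (wt-⊕ x y)) (interchange a b (wt x) (wt y))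
  where
  interchange : ∀ a b c d → a ℤ.+ b ℤ.+ (c ℤ.+ d) ≡ a ℤ.+ c ℤ.+ (b ℤ.+ d)
  interchange = solve-∀

wt-zeros : ∀ k → wt (tabulate {n = k} (λ _ → 0ℤ)) ≡ 0ℤ
wt-zeros zero    = refl
wt-zeros (suc k) = trans (ℤP.+-identityˡ _) (wt-zeros k)

wt-unitVec : ∀ {k} (c : Fin k) → wt (unitVec c) ≡ 1ℤ
wt-unitVec {suc k} Fin.zero    = cong (λ z → 1ℤ ℤ.+ z) (wt-zeros k)
wt-unitVec {suc k} (Fin.suc c) = trans (ℤP.+-identityˡ _) (trans (cong wt shift) (wt-unitVec c))
  where
  shift : tabulate (λ d → if ⌊ Fin.suc c FinP.≟ Fin.suc d ⌋ then 1ℤ else 0ℤ) ≡ unitVec c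
  shift = VecP.tabulate-cong (λ d → cong (if_then 1ℤ else 0ℤ) (⌊⌋-map′ (cong Fin.suc) FinP.suc-injective (c FinP.≟ d)))

wt-⊕-unitVec : ∀ {k} (x : Point k) c → wt (x ⊕ unitVec c) ≡ wt x ℤ.+ 1ℤ
wt-⊕-unitVec x c = trans (wt-⊕ x (unitVec c)) (cong (λ z → wt x ℤ.+ z) (wt-unitVec c))

≼-tail : ∀ {k a b} {x y : Point k} → (a ∷ x) ≼ (b ∷ y) → x ≼ y
≼-tail x≼y = coordinatewise (λ c → ≤-at x≼y (Fin.suc c))

wt-mono : ∀ {k} {x y : Point k} → x ≼ y → wt x ℤ.≤ wt y
wt-mono {x = []}    {[]}    _   = ℤP.≤-refl
wt-mono {x = a ∷ x} {b ∷ y} x≼y =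
  ℤP.+-mono-≤ (≤-at x≼y Fin.zero) (wt-mono (≼-tail x≼y))

≼∧wt≡⇒≡ : ∀ {k} {x y : Point k} → x ≼ y → wt x ≡ wt y → x ≡ y
≼∧wt≡⇒≡ {x = []}    {[]}    _   _    = refl
≼∧wt≡⇒≡ {x = a ∷ x} {b ∷ y} x≼y wt≡ with a ℤ.≟ b
... | yes refl = cong (a ∷_) (≼∧wt≡⇒≡ (≼-tail x≼y) (+-Group.∙-cancelˡ a (wt x) (wt y) wt≡))
... | no  a≢b  = ⊥-elim (ℤP.<-irrefl wt≡ (ℤP.+-mono-<-≤ (ℤP.≤∧≢⇒< (≤-at x≼y Fin.zero) a≢b)
                                           (wt-mono (≼-tail x≼y))))

module Greedy {k : ℕ} (u v : Point k) where

  open CubeCriterion u v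

  E-step-≡ : ∀ w c → E (w ⊕ unitVec c) c ≡ E w c ℤ.+ 1ℤ
  E-step-≡ w c = trans (cong (ℤ._- lookup u c) (lookup-⊕-unitVec-≡ w c)) (shift (lookup w c) (lookup u c))
    where
    shift : ∀ x y → x ℤ.+ 1ℤ ℤ.- y ≡ x ℤ.- y ℤ.+ 1ℤ
    shift = solve-∀

  E-step-≢ : ∀ w {c d} → c ≢ d → E (w ⊕ unitVec c) d ≡ E w d
  E-step-≢ w c≢d = cong (ℤ._- lookup u _) (lookup-⊕-unitVec-≢ w c≢d)

  Meets : ℤ → ℤ → ℤ → ℤ → Set
  Meets e e′ d d′ = (+ 2 ℤ.* e ℤ.- 1ℤ) ℤ.* d′ ℤ.≤ (+ 2 ℤ.* e′ ℤ.+ 1ℤ) ℤ.* d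

  box⇒≼ : ∀ {w} → InBox w → w ≼ v
  box⇒≼ {w} box = coordinatewise λ c →
    ≤-by-difference _ (ℤP.i≤j⇒0≤j-i (proj₂ (box c))) (rebase (lookup u c) (lookup v c) (lookup w c))
    where
    rebase : ∀ u v w → v ℤ.- w ≡ (v ℤ.- u) ℤ.- (w ℤ.- u)
    rebase = solve-∀

  Meets-raise : ∀ e e′ d d′ → 0ℤ ℤ.≤ d → Meets e e′ d d′ → Meets e (e′ ℤ.+ 1ℤ) d d′
  Meets-raise e e′ d d′ 0≤d met = ℤP.≤-trans met (≤-by-difference _ (ℤP.*-monoˡ-≤-nonNeg (+ 2) 0≤d) (widen e′ d))
    where
    widen : ∀ e′ d → (+ 2 ℤ.* (e′ ℤ.+ 1ℤ) ℤ.+ 1ℤ) ℤ.* d ℤ.- (+ 2 ℤ.* e′ ℤ.+ 1ℤ) ℤ.* d ≡ + 2 ℤ.* d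
    widen = solve-∀

  module _ (w : Point k) (box : InBox w) (m : Fin k) (Em<Dm : E w m ℤ.< D m) where

    private
      0≤D : ∀ c → 0ℤ ℤ.≤ D c
      0≤D c = ℤP.≤-trans (proj₁ (box c)) (proj₂ (box c))
      Em+1≤Dm : E w m ℤ.+ 1ℤ ℤ.≤ D m
      Em+1≤Dm = subst (ℤ._≤ D m) (ℤP.+-comm 1ℤ (E w m)) (ℤP.i<j⇒suc[i]≤j Em<Dm)

    step-box : InBox (w ⊕ unitVec m)
    step-box c with m FinP.≟ c
    ... | yes refl = subst (λ e → (0ℤ ℤ.≤ e) × (e ℤ.≤ D m)) (sym (E-step-≡ w m))
                       (ℤP.≤-trans (proj₁ (box m)) (ℤP.i≤i+j (E w m) 1ℤ) , Em+1≤Dm)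
    ... | no  m≢c  = subst (λ e → (0ℤ ℤ.≤ e) × (e ℤ.≤ D c)) (sym (E-step-≢ w m≢c)) (box c)

    -- If E c′ = D c′ then the t-interval of c′ reaches past 1, beyond the new lower end of m.
    step-meets : (∀ c → E w c ℤ.< D c → hi w m ℤ.* D c ℤ.≤ hi w c ℤ.* D m) →
                 ∀ c′ → Meets (E w m ℤ.+ 1ℤ) (E w c′) (D m) (D c′)
    step-meets earliest c′ with E w c′ ℤ.<? D c′
    ... | yes Ec′<Dc′ = subst (λ a → a ℤ.* D c′ ℤ.≤ hi w c′ ℤ.* D m) (shift (E w m)) (earliest c′ Ec′<Dc′)
      where
      shift : ∀ e → + 2 ℤ.* e ℤ.+ 1ℤ ≡ + 2 ℤ.* (e ℤ.+ 1ℤ) ℤ.- 1ℤ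
      shift = solve-∀
    ... | no  Ec′≮Dc′ = subst (λ e → Meets (E w m ℤ.+ 1ℤ) e (D m) (D c′)) Dc′≡Ec′
                          (≤-by-difference _ 0≤gap (expand (E w m) (D m) (D c′)))
      where
      Dc′≡Ec′ : D c′ ≡ E w c′
      Dc′≡Ec′ = ℤP.≤-antisym (ℤP.≮⇒≥ Ec′≮Dc′) (proj₂ (box c′))
      0≤gap : 0ℤ ℤ.≤ + 2 ℤ.* D c′ ℤ.* (D m ℤ.- (E w m ℤ.+ 1ℤ)) ℤ.+ (D c′ ℤ.+ D m)
      0≤gap = ℤP.+-mono-≤ (0≤i∧0≤j⇒0≤i*j (0≤i∧0≤j⇒0≤i*j (0≤+ 2) (0≤D c′)) (ℤP.i≤j⇒0≤j-i Em+1≤Dm))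
                          (ℤP.+-mono-≤ (0≤D c′) (0≤D m))
      expand : ∀ e d d′ → (+ 2 ℤ.* d′ ℤ.+ 1ℤ) ℤ.* d ℤ.- (+ 2 ℤ.* (e ℤ.+ 1ℤ) ℤ.- 1ℤ) ℤ.* d′
                          ≡ + 2 ℤ.* d′ ℤ.* (d ℤ.- (e ℤ.+ 1ℤ)) ℤ.+ (d′ ℤ.+ d)
      expand = solve-∀

  step-criterion : ∀ w → Criterion w → ∀ m → E w m ℤ.< D m →
                   (∀ c → E w c ℤ.< D c → hi w m ℤ.* D c ℤ.≤ hi w c ℤ.* D m) → Criterion (w ⊕ unitVec m)
  step-criterion w (box , meet) m Em<Dm earliest = step-box w box m Em<Dm , meet′
    where
    0≤D : ∀ c → 0ℤ ℤ.≤ D c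
    0≤D c = ℤP.≤-trans (proj₁ (box c)) (proj₂ (box c))
    meet′ : IntervalsMeet (w ⊕ unitVec m)
    meet′ c c′ with m FinP.≟ c | m FinP.≟ c′
    ... | yes refl | yes refl = subst₂ (λ e e′ → Meets e e′ (D m) (D m)) (sym (E-step-≡ w m)) (sym (E-step-≡ w m))
                                  (Meets-raise (E w m ℤ.+ 1ℤ) (E w m) (D m) (D m) (0≤D m)
                                               (ℤP.≤-reflexive (same (E w m) (D m))))
      where
      same : ∀ e d → (+ 2 ℤ.* (e ℤ.+ 1ℤ) ℤ.- 1ℤ) ℤ.* d ≡ (+ 2 ℤ.* e ℤ.+ 1ℤ) ℤ.* d
      same = solve-∀
    ... | yes refl | no  m≢c′ = subst₂ (λ e e′ → Meets e e′ (D m) (D c′)) (sym (E-step-≡ w m)) (sym (E-step-≢ w m≢c′))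
                                  (step-meets w box m Em<Dm earliest c′)
    ... | no  m≢c  | yes refl = subst₂ (λ e e′ → Meets e e′ (D c) (D m)) (sym (E-step-≢ w m≢c)) (sym (E-step-≡ w m))
                                  (Meets-raise (E w c) (E w m) (D c) (D m) (0≤D c) (meet c m))
    ... | no  m≢c  | no  m≢c′ = subst₂ (λ e e′ → Meets e e′ (D c) (D c′)) (sym (E-step-≢ w m≢c)) (sym (E-step-≢ w m≢c′))
                                  (meet c c′)

  module _ (w : Point k) (box : InBox w) where

    private
      open-coordinate⇒0<D : ∀ {c} → E w c ℤ.< D c → 0ℤ ℤ.< D c
      open-coordinate⇒0<D {c} = ℤP.≤-<-trans (proj₁ (box c))

      upper-end-trans : ∀ {x y z} → E w x ℤ.< D x → E w y ℤ.< D y → E w z ℤ.< D z →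
                        hi w x ℤ.* D y ℤ.≤ hi w y ℤ.* D x → hi w y ℤ.* D z ℤ.≤ hi w z ℤ.* D y →
                        hi w x ℤ.* D z ℤ.≤ hi w z ℤ.* D x
      upper-end-trans {x} {y} {z} x-open y-open z-open =
        cross-≤-trans (hi w x) (D x) (hi w y) (D y) (hi w z) (D z) (ℤP.<⇒≤ (open-coordinate⇒0<D x-open))
          (ℤ.positive (open-coordinate⇒0<D y-open)) (ℤP.<⇒≤ (open-coordinate⇒0<D z-open))

    -- c ⊑ c′ when the upper end of the t-interval of c is at most that of c′
    module Earliest = LeastBy (λ c → E w c ℤ.< D c) (λ c → E w c ℤ.<? D c)
      (λ c c′ → hi w c ℤ.* D c′ ℤ.≤ hi w c′ ℤ.* D c) (λ c c′ → hi w c ℤ.* D c′ ℤ.≤? hi w c′ ℤ.* D c)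
      (λ ≰ → ℤP.<⇒≤ (ℤP.≰⇒> ≰)) upper-end-trans

  GreedyPath : ℕ → Point k → Set
  GreedyPath m w = Σ (Vec (Point k) (suc m)) λ p →
                   head p ≡ w × last p ≡ v × MonotonePath p × (∀ t → Criterion (lookup p t))

  -- Always step in a coordinate whose t-interval ends first; this keeps the invariant.
  greedy : ∀ m w → Criterion w → wt v ≡ wt w ℤ.+ + m → GreedyPath m w
  greedy zero    w crit wt≡ =
    w ∷ [] , refl , ≼∧wt≡⇒≡ (box⇒≼ (proj₁ crit)) (sym (trans wt≡ (ℤP.+-identityʳ (wt w)))) , (λ ()) , λ { Fin.zero → crit }
  greedy (suc m) w crit wt≡ = next (Earliest.least w (proj₁ crit) (allFin k))
    where
    prepend : ∀ {c} → GreedyPath m (w ⊕ unitVec c) → GreedyPath (suc m) w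
    prepend {c} (q ∷ qs , q≡ , last≡ , mono , crits) = w ∷ q ∷ qs , refl , last≡ , mono′ , crits′
      where
      mono′ : MonotonePath (w ∷ q ∷ qs)
      mono′ Fin.zero    = c , q≡
      mono′ (Fin.suc t) = mono t
      crits′ : ∀ t → Criterion (lookup (w ∷ q ∷ qs) t)
      crits′ Fin.zero    = crit
      crits′ (Fin.suc t) = crits t

    next : Earliest.Least w (proj₁ crit) (allFin k) → GreedyPath (suc m) w
    next (Earliest.none saturated) = ⊥-elim (ℤP.<-irrefl refl (ℤP.<-≤-trans wt-w<wt-v (wt-mono v≼w)))
      where
      v≼w : v ≼ w
      v≼w = coordinatewise λ c →
        ≤-by-difference _ (ℤP.i≤j⇒0≤j-i (ℤP.≮⇒≥ (All.lookup saturated (∈-allFin c))))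
          (rebase (lookup u c) (lookup v c) (lookup w c))
        where
        rebase : ∀ u v w → w ℤ.- v ≡ (w ℤ.- u) ℤ.- (v ℤ.- u)
        rebase = solve-∀
      wt-w<wt-v : wt w ℤ.< wt v
      wt-w<wt-v = subst₂ ℤ._<_ (ℤP.+-identityʳ (wt w)) (sym wt≡) (ℤP.+-monoʳ-< (wt w) (ℤ.+<+ (ℕ.s≤s ℕ.z≤n)))
    next (Earliest.some c Ec<Dc earliest) =
      prepend (greedy m (w ⊕ unitVec c) (step-criterion w crit c Ec<Dc (λ c′ → All.lookup earliest (∈-allFin c′))) wt≡′)
      where
      wt≡′ : wt v ≡ wt (w ⊕ unitVec c) ℤ.+ + m
      wt≡′ = trans wt≡ (trans (sym (ℤP.+-assoc (wt w) 1ℤ (+ m))) (cong (ℤ._+ + m) (sym (wt-⊕-unitVec w c))))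

  criterion-start : u ≼ v → Criterion u
  criterion-start u≼v = (λ c → subst (λ e → (0ℤ ℤ.≤ e) × (e ℤ.≤ D c)) (sym (E-u c)) (ℤP.≤-refl , 0≤D c)) ,
                        λ c c′ → subst₂ (λ e e′ → Meets e e′ (D c) (D c′)) (sym (E-u c)) (sym (E-u c′))
                                   (≤-by-difference _ (ℤP.+-mono-≤ (0≤D c) (0≤D c′)) (start (D c) (D c′)))
    where
    E-u : ∀ c → E u c ≡ 0ℤ
    E-u c = ℤP.+-inverseʳ (lookup u c)
    0≤D : ∀ c → 0ℤ ℤ.≤ D c
    0≤D c = ℤP.i≤j⇒0≤j-i (≤-at u≼v c)
    start : ∀ d d′ → (+ 2 ℤ.* 0ℤ ℤ.+ 1ℤ) ℤ.* d ℤ.- (+ 2 ℤ.* 0ℤ ℤ.- 1ℤ) ℤ.* d′ ≡ d ℤ.+ d′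
    start = solve-∀

  admissible-path : ∀ ρ → u ≼ v → wt v ≡ wt u ℤ.+ + ρ → ∃ (Admissible ρ u v)
  admissible-path ρ u≼v wt≡ = from-greedy (greedy ρ u (criterion-start u≼v) wt≡)
    where
    from-greedy : GreedyPath ρ u → ∃ (Admissible ρ u v)
    from-greedy (p , head≡ , last≡ , mono , crits) = p , head≡ , last≡ , mono , λ t → criterion⇒cube (lookup p t) (crits t)

-- Indexing by ℕ, searches and tubes

at-lookup : (xs : Vec A (suc m)) (i : Fin (suc m)) → at xs (toℕ i) ≡ lookup xs i
at-lookup (x ∷ [])     Fin.zero    = refl
at-lookup (x ∷ y ∷ xs) Fin.zero    = refl
at-lookup (x ∷ y ∷ xs) (Fin.suc i) = at-lookup (y ∷ xs) i

at-clamp : (xs : Vec A (suc m)) (t : ℕ) → m ≤ t → at xs t ≡ at xs m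
at-clamp (x ∷ [])     t       _       = refl
at-clamp (x ∷ y ∷ xs) (suc t) (s≤s h) = at-clamp (y ∷ xs) t h

at-tabulate : (f : ℕ → A) (t : ℕ) → t ≤ m → at (tabulate {n = suc m} (λ i → f (toℕ i))) t ≡ f t
at-tabulate {m = zero}  f zero    _       = refl
at-tabulate {m = suc m} f zero    _       = refl
at-tabulate {m = suc m} f (suc t) (s≤s h) = at-tabulate {m = m} (λ i → f (suc i)) t h

at-head : (xs : Vec A (suc m)) → at xs 0 ≡ head xs
at-head (x ∷ [])     = refl
at-head (x ∷ y ∷ xs) = refl

at-last : (xs : Vec A (suc m)) → at xs m ≡ last xs
at-last (x ∷ [])     = refl
at-last (x ∷ y ∷ xs) = at-last (y ∷ xs)

≡-by-at : (xs ys : Vec A (suc m)) → (∀ t → t ≤ m → at xs t ≡ at ys t) → xs ≡ ys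
≡-by-at xs ys at≡ = trans (sym (VecP.tabulate∘lookup xs)) (trans (VecP.tabulate-cong λ i →
  trans (sym (at-lookup xs i)) (trans (at≡ (toℕ i) (ℕP.≤-pred (FinP.toℕ<n i))) (at-lookup ys i))) (VecP.tabulate∘lookup ys))

at-block : ∀ {k} ρ (s : Vec (Point k) (suc m)) a j → j ≤ ρ → at (block ρ s a) j ≡ at s (a + j)
at-block ρ s a j j≤ρ = at-tabulate {m = ρ} (λ t → at s (a + t)) j j≤ρ

Floor : (ℕ → Bool) → ℕ → Set
Floor p lo = (lo ≡ 0) ⊎ (p lo ≡ true)

searchDown-≤ : ∀ p m → searchDown p m ≤ m
searchDown-≤ p zero    = z≤n
searchDown-≤ p (suc m) with p (suc m)
... | true  = ℕP.≤-refl
... | false = ℕP.m≤n⇒m≤1+n (searchDown-≤ p m)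

searchDown-floor : ∀ p m → Floor p (searchDown p m)
searchDown-floor p zero    = inj₁ refl
searchDown-floor p (suc m) with p (suc m) in eq
... | true  = inj₂ eq
... | false = searchDown-floor p m

private
  floor-below : ∀ p {lo m} → Floor p lo → p (suc m) ≡ false → lo ≤ suc m → lo ≤ m
  floor-below p floor miss lo≤ with ℕP.m≤n⇒m<n∨m≡n lo≤
  ... | inj₁ (s≤s lo≤m) = lo≤m
  ... | inj₂ refl with floor
  ...   | inj₂ hit with trans (sym miss) hit
  ...     | ()

searchDown-≥ : ∀ p {lo} m → Floor p lo → lo ≤ m → lo ≤ searchDown p m
searchDown-≥ p zero    floor lo≤ = lo≤
searchDown-≥ p (suc m) floor lo≤ with p (suc m) in eq
... | true  = lo≤
... | false = searchDown-≥ p m floor (floor-below p floor eq lo≤)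

searchDown-cong : ∀ p p′ {lo} m → (∀ i → lo ≤ i → i ≤ m → p i ≡ p′ i) → Floor p lo → lo ≤ m →
                  searchDown p m ≡ searchDown p′ m
searchDown-cong p p′ zero    agree floor lo≤ = refl
searchDown-cong p p′ (suc m) agree floor lo≤ with p (suc m) in eq | p′ (suc m) | agree (suc m) lo≤ ℕP.≤-refl
... | true  | .true  | refl = refl
... | false | .false | refl =
  searchDown-cong p p′ m (λ i lo≤i i≤m → agree i lo≤i (ℕP.m≤n⇒m≤1+n i≤m)) floor (floor-below p floor eq lo≤)

searchUp-≤ : ∀ p fuel i → searchUp p fuel i ≤ i + fuel
searchUp-≤ p zero       i = ℕP.≤-reflexive (sym (ℕP.+-identityʳ i))
searchUp-≤ p (suc fuel) i with p i
... | true  = ℕP.m≤m+n i (suc fuel)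
... | false = subst (searchUp p fuel (suc i) ≤_) (sym (ℕP.+-suc i fuel)) (searchUp-≤ p fuel (suc i))

searchUp-hit : ∀ p fuel i → (searchUp p fuel i ≡ i + fuel) ⊎ (p (searchUp p fuel i) ≡ true)
searchUp-hit p zero       i = inj₁ (sym (ℕP.+-identityʳ i))
searchUp-hit p (suc fuel) i with p i in eq
... | true  = inj₂ eq
... | false with searchUp-hit p fuel (suc i)
...   | inj₁ at-end = inj₁ (trans at-end (sym (ℕP.+-suc i fuel)))
...   | inj₂ hit    = inj₂ hit

Ceiling : (ℕ → Bool) → ℕ → ℕ → ℕ → Set
Ceiling p fuel i hi = hi ≤ i + fuel → p hi ≡ true

private
  ceiling-above : ∀ p {fuel i hi} → Ceiling p (suc fuel) i hi → p i ≡ false → i ≤ hi →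
                  suc i ≤ hi × Ceiling p fuel (suc i) hi
  ceiling-above p {fuel} {i} {hi} ceiling miss i≤hi = i<hi , λ hi≤ → ceiling (subst (hi ≤_) (sym (ℕP.+-suc i fuel)) hi≤)
    where
    i<hi : suc i ≤ hi
    i<hi with ℕP.m≤n⇒m<n∨m≡n i≤hi
    ... | inj₁ i<hi = i<hi
    ... | inj₂ refl with trans (sym miss) (ceiling (ℕP.m≤m+n i (suc fuel)))
    ...   | ()

searchUp-≤-ceiling : ∀ p fuel i {hi} → i ≤ hi → Ceiling p fuel i hi → searchUp p fuel i ≤ hi
searchUp-≤-ceiling p zero       i i≤hi _       = i≤hi
searchUp-≤-ceiling p (suc fuel) i i≤hi ceiling with p i in eq
... | true  = i≤hi
... | false = let i<hi , ceiling′ = ceiling-above p ceiling eq i≤hi in searchUp-≤-ceiling p fuel (suc i) i<hi ceiling′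

searchUp-cong : ∀ p p′ fuel i {hi} → i ≤ hi → (∀ j → i ≤ j → j ≤ hi → p j ≡ p′ j) → Ceiling p fuel i hi →
                searchUp p fuel i ≡ searchUp p′ fuel i
searchUp-cong p p′ zero       i i≤hi agree ceiling = refl
searchUp-cong p p′ (suc fuel) i i≤hi agree ceiling with p i in eq | p′ i | agree i ℕP.≤-refl i≤hi
... | true  | .true  | refl = refl
... | false | .false | refl = let i<hi , ceiling′ = ceiling-above p ceiling eq i≤hi in
  searchUp-cong p p′ fuel (suc i) i<hi (λ j i<j j≤hi → agree j (ℕP.<⇒≤ i<j) j≤hi) ceiling′

+-ρ-≤ : ∀ ρ {a b} → ρ ∣ a → ρ ∣ b → a < b → a + ρ ≤ b
+-ρ-≤ ρ {b = b} (divides p refl) (divides q refl) a<b =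
  subst (_≤ q * ρ) (ℕP.+-comm ρ (p * ρ)) (ℕP.*-monoˡ-≤ ρ (ℕP.*-cancelʳ-< ρ p q a<b))

∣i∣≤n⇒-n≤i≤n : ∀ i n → ℤ.∣ i ∣ ≤ n → (ℤ.- + n ℤ.≤ i) × (i ℤ.≤ + n)
∣i∣≤n⇒-n≤i≤n (+ m)    n       ∣i∣≤n       = ℤP.≤-trans (ℤP.neg-≤-pos {n}) (0≤+ m) , ℤ.+≤+ ∣i∣≤n
∣i∣≤n⇒-n≤i≤n -[1+ m ] (suc n) (s≤s m≤n) = ℤ.-≤- m≤n , ℤ.-≤+

wt-between : ∀ {k} (x : Point k) lo hi → VecAll.All (λ c → (lo ℤ.≤ c) × (c ℤ.≤ hi)) x →
             (+ k ℤ.* lo ℤ.≤ wt x) × (wt x ℤ.≤ + k ℤ.* hi)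
wt-between []      lo hi []                = ℤP.≤-reflexive (ℤP.*-zeroˡ lo) , ℤP.≤-reflexive (sym (ℤP.*-zeroˡ hi))
wt-between {suc k} (c ∷ x) lo hi ((lo≤c , c≤hi) ∷ rest) =
  subst (ℤ._≤ c ℤ.+ wt x) (sym (unfold (+ k) lo)) (ℤP.+-mono-≤ lo≤c (proj₁ (wt-between x lo hi rest))) ,
  subst (c ℤ.+ wt x ℤ.≤_) (sym (unfold (+ k) hi)) (ℤP.+-mono-≤ c≤hi (proj₂ (wt-between x lo hi rest)))
  where
  unfold : ∀ k x → (1ℤ ℤ.+ k) ℤ.* x ≡ x ℤ.+ k ℤ.* x
  unfold = solve-∀

tube-coordinate : ∀ {k} n L (x : Point k) → InTube n L x → ∀ c →
                  (+ k ℤ.* lookup x c ℤ.≤ wt x ℤ.+ + 2 ℤ.* + k ℤ.* + L) ×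
                  (wt x ℤ.≤ + k ℤ.* lookup x c ℤ.+ + 2 ℤ.* + k ℤ.* + L)
tube-coordinate {k} n L x (_ , i , near) c =
  ≤-by-difference _ (ℤP.+-mono-≤ (ℤP.i≤j⇒0≤j-i (proj₁ wt-bounds)) (0≤i∧0≤j⇒0≤i*j (0≤+ k) (ℤP.i≤j⇒0≤j-i (proj₂ at-c))))
                    (upper (+ k) (lookup x c) (wt x) I (+ L)) ,
  ≤-by-difference _ (ℤP.+-mono-≤ (ℤP.i≤j⇒0≤j-i (proj₂ wt-bounds)) (0≤i∧0≤j⇒0≤i*j (0≤+ k) (ℤP.i≤j⇒0≤j-i (proj₁ at-c))))
                    (lower (+ k) (lookup x c) (wt x) I (+ L))
  where
  I = + toℕ i
  centred : ∀ {z} → ℤ.∣ z ℤ.- I ∣ ≤ L → (I ℤ.- + L ℤ.≤ z) × (z ℤ.≤ I ℤ.+ + L)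
  centred {z} h = let lo , hi = ∣i∣≤n⇒-n≤i≤n (z ℤ.- I) L h in
    ≤-by-difference _ (ℤP.i≤j⇒0≤j-i lo) (shift₁ z I (+ L)) , ≤-by-difference _ (ℤP.i≤j⇒0≤j-i hi) (shift₂ z I (+ L))
    where
    shift₁ : ∀ z I L → z ℤ.- (I ℤ.- L) ≡ (z ℤ.- I) ℤ.- ℤ.- L
    shift₁ = solve-∀
    shift₂ : ∀ z I L → (I ℤ.+ L) ℤ.- z ≡ L ℤ.- (z ℤ.- I)
    shift₂ = solve-∀
  coordinates = VecAll.map centred near
  wt-bounds = wt-between x (I ℤ.- + L) (I ℤ.+ + L) coordinates
  at-c : (I ℤ.- + L ℤ.≤ lookup x c) × (lookup x c ℤ.≤ I ℤ.+ + L)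
  at-c = VecAllP.lookup⁺ coordinates c
  upper : ∀ k xc W I L → W ℤ.+ + 2 ℤ.* k ℤ.* L ℤ.- k ℤ.* xc ≡ (W ℤ.- k ℤ.* (I ℤ.- L)) ℤ.+ k ℤ.* ((I ℤ.+ L) ℤ.- xc)
  upper = solve-∀
  lower : ∀ k xc W I L → k ℤ.* xc ℤ.+ + 2 ℤ.* k ℤ.* L ℤ.- W ≡ (k ℤ.* (I ℤ.+ L) ℤ.- W) ℤ.+ k ℤ.* (xc ℤ.- (I ℤ.- L))
  lower = solve-∀

tube-≼ : ∀ {k} n L {x y : Point k} → NonZero k → InTube n L x → InTube n L y →
         wt x ℤ.+ + 4 ℤ.* + k ℤ.* + L ℤ.≤ wt y → x ≼ y
tube-≼ {k} n L {x} {y} k≢0 x∈T y∈T far = coordinatewise λ c →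
  ℤP.*-cancelˡ-≤-pos (lookup x c) (lookup y c) (+ k) {{ℤ.positive (ℤ.+<+ (ℕ.>-nonZero⁻¹ k {{k≢0}}))}}
    (≤-by-difference _ (ℤP.+-mono-≤ (ℤP.+-mono-≤ (ℤP.i≤j⇒0≤j-i (proj₁ (tube-coordinate n L x x∈T c)))
                                                  (ℤP.i≤j⇒0≤j-i (proj₂ (tube-coordinate n L y y∈T c))))
                                     (ℤP.i≤j⇒0≤j-i far))
                       (split (+ k ℤ.* lookup x c) (+ k ℤ.* lookup y c) (wt x) (wt y) (+ k) (+ L)))
  where
  split : ∀ kx ky X Y k L → ky ℤ.- kx ≡ (X ℤ.+ + 2 ℤ.* k ℤ.* L ℤ.- kx) ℤ.+ (ky ℤ.+ + 2 ℤ.* k ℤ.* L ℤ.- Y)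
                                      ℤ.+ (Y ℤ.- (X ℤ.+ + 4 ℤ.* k ℤ.* L))
  split = solve-∀

-- Spines from connecting points

module Spines (n k L ρ : ℕ) {{ρ≢0 : NonZero ρ}} (ρ∣K : ρ ∣ topIndex n k) (k≢0 : NonZero k)
              (wide : + 4 ℤ.* + k ℤ.* + L ℤ.≤ + ρ) where

  K : ℕ
  K = topIndex n k

  ρ∣a<K⇒a+ρ≤K : ∀ {a} → ρ ∣ a → a < K → a + ρ ≤ K
  ρ∣a<K⇒a+ρ≤K ρ∣a a<K = +-ρ-≤ ρ ρ∣a ρ∣K a<K

  anchor offset : ℕ → ℕ
  anchor t = t / ρ * ρ
  offset t = t % ρ

  anchor+offset : ∀ t → anchor t + offset t ≡ t
  anchor+offset t = trans (ℕP.+-comm (anchor t) (offset t)) (sym (m≡m%n+[m/n]*n t ρ))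

  ρ∣anchor : ∀ t → ρ ∣ anchor t
  ρ∣anchor t = divides (t / ρ) refl

  offset<ρ : ∀ t → offset t < ρ
  offset<ρ t = m%n<n t ρ

  anchor-unique : ∀ {a j} → ρ ∣ a → j < ρ → anchor (a + j) ≡ a × offset (a + j) ≡ j
  anchor-unique {a} {j} (divides q refl) j<ρ =
    trans (cong (_* ρ) (trans (+-distrib-/-∣ˡ j (divides q refl)) (cong₂ _+_ (m*n/n≡m q ρ) (m<n⇒m/n≡0 j<ρ))))
          (cong (_* ρ) (ℕP.+-identityʳ q)) ,
    trans (cong (_% ρ) (ℕP.+-comm (q * ρ) j)) (trans ([m+kn]%n≡m%n j q ρ) (m<n⇒m%n≡m j<ρ))

  -- The vertices of the spine induced by the connecting points χ a (ρ ∣ a).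
  vertex : (ℕ → Point k) → ℕ → Point k
  vertex χ t = at (lexMinPath ρ (χ (anchor t)) (χ (anchor t + ρ))) (offset t)

  spineOf : (ℕ → Point k) → Spine n k
  spineOf χ = tabulate (λ i → vertex χ (toℕ i))

  at-spineOf : ∀ χ {t} → t ≤ K → at (spineOf χ) t ≡ vertex χ t
  at-spineOf χ {t} = at-tabulate (vertex χ) t

  vertex-inside : ∀ χ {a j} → ρ ∣ a → j < ρ → vertex χ (a + j) ≡ at (lexMinPath ρ (χ a) (χ (a + ρ))) j
  vertex-inside χ {a} {j} ρ∣a j<ρ with anchor-unique ρ∣a j<ρ
  ... | anchor≡ , offset≡ = cong₂ (λ b i → at (lexMinPath ρ (χ b) (χ (b + ρ))) i) anchor≡ offset≡

  vertex-at-anchor : ∀ χ t → offset t ≡ 0 → vertex χ t ≡ χ (anchor t)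
  vertex-at-anchor χ t offset≡0 =
    trans (cong (at (lexMinPath ρ _ _)) offset≡0)
          (trans (at-head (lexMinPath ρ _ _)) (head-lexMinPath ρ (χ (anchor t)) (χ (anchor t + ρ))))

  anchor≤ : ∀ t → anchor t ≤ t
  anchor≤ t = subst (anchor t ≤_) (anchor+offset t) (ℕP.m≤m+n (anchor t) (offset t))

  <anchor+ρ : ∀ t → t < anchor t + ρ
  <anchor+ρ t = subst (_< anchor t + ρ) (anchor+offset t) (ℕP.+-monoʳ-< (anchor t) (offset<ρ t))

  vertex-at-multiple : ∀ χ {a} → ρ ∣ a → vertex χ a ≡ χ a
  vertex-at-multiple χ {a} ρ∣a with anchor-unique {j = 0} ρ∣a (ℕ.>-nonZero⁻¹ ρ)
  ... | anchor≡ , offset≡ = subst (λ b → vertex χ b ≡ χ a) (ℕP.+-identityʳ a)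
                                  (trans (vertex-at-anchor χ (a + 0) offset≡) (cong χ anchor≡))

  vertex-cong : ∀ χ χ′ t → (∀ b → ρ ∣ b → t < b + ρ → b < t + ρ → χ b ≡ χ′ b) → vertex χ t ≡ vertex χ′ t
  vertex-cong χ χ′ t agree with offset t ℕ.≟ 0
  ... | yes offset≡0 = trans (vertex-at-anchor χ t offset≡0)
                             (trans (agree-at-anchor) (sym (vertex-at-anchor χ′ t offset≡0)))
    where
    agree-at-anchor = agree (anchor t) (ρ∣anchor t) (<anchor+ρ t) (ℕP.≤-<-trans (anchor≤ t) (ℕP.m<m+n t (ℕ.>-nonZero⁻¹ ρ)))
  ... | no  offset≢0 = cong₂ (λ x y → at (lexMinPath ρ x y) (offset t))
      (agree (anchor t) (ρ∣anchor t) (<anchor+ρ t) (ℕP.<-trans anchor<t (ℕP.m<m+n t (ℕ.>-nonZero⁻¹ ρ))))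
      (agree (anchor t + ρ) (∣m∣n⇒∣m+n (ρ∣anchor t) ∣-refl) (ℕP.<-≤-trans (<anchor+ρ t) (ℕP.m≤m+n _ ρ))
             (ℕP.+-monoˡ-< ρ anchor<t))
    where
    anchor<t : anchor t < t
    anchor<t = subst (anchor t <_) (anchor+offset t) (ℕP.m<m+n (anchor t) (ℕP.n≢0⇒n>0 offset≢0))

  lexMinPath-between-lows : ∀ {a x y} → InLow n L a x → InLow n L (a + ρ) y → LexMinAdmissible ρ x y (lexMinPath ρ x y)
  lexMinPath-between-lows {a} {x} {y} (x∈T , wt-x) (y∈T , wt-y) =
    lexMinPath-lexMin ρ (proj₂ (Greedy.admissible-path x y ρ (tube-≼ n L k≢0 x∈T y∈T wt-x+4kL≤wt-y) wt-y≡))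
    where
    wt-y≡ : wt y ≡ wt x ℤ.+ + ρ
    wt-y≡ = trans wt-y (cong (ℤ._+ + ρ) (sym wt-x))
    wt-x+4kL≤wt-y : wt x ℤ.+ + 4 ℤ.* + k ℤ.* + L ℤ.≤ wt y
    wt-x+4kL≤wt-y = ℤP.≤-trans (ℤP.+-monoʳ-≤ (wt x) wide) (ℤP.≤-reflexive (sym wt-y≡))

  ValidConnecting : (ℕ → Point k) → Set
  ValidConnecting χ = ∀ a → a ≤ K → ρ ∣ a → InLow n L a (χ a)

  spineOf-at-multiple : ∀ χ {a} → a ≤ K → ρ ∣ a → at (spineOf χ) a ≡ χ a
  spineOf-at-multiple χ a≤K ρ∣a = trans (at-spineOf χ a≤K) (vertex-at-multiple χ ρ∣a)

  spineOf-induced : ∀ χ → ValidConnecting χ → IsInducedSpine n k L ρ (spineOf χ)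
  spineOf-induced χ valid =
    (λ a a≤K ρ∣a → subst (InLow n L a) (sym (spineOf-at-multiple χ a≤K ρ∣a)) (valid a a≤K ρ∣a)) ,
    λ a a<K ρ∣a → let ρ∣a+ρ = ∣m∣n⇒∣m+n ρ∣a ∣-refl ; a+ρ≤K = ρ∣a<K⇒a+ρ≤K ρ∣a a<K
                      lexMin = lexMinPath-between-lows (valid a (ℕP.<⇒≤ a<K) ρ∣a) (valid (a + ρ) a+ρ≤K ρ∣a+ρ) in
      subst₂ (λ x y → LexMinAdmissible ρ x y (block ρ (spineOf χ) a))
             (sym (spineOf-at-multiple χ (ℕP.<⇒≤ a<K) ρ∣a)) (sym (spineOf-at-multiple χ a+ρ≤K ρ∣a+ρ))
             (subst (LexMinAdmissible ρ (χ a) (χ (a + ρ))) (sym (block≡ a<K ρ∣a lexMin)) lexMin)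
    where
    block≡ : ∀ {a} → a < K → ρ ∣ a → LexMinAdmissible ρ (χ a) (χ (a + ρ)) (lexMinPath ρ (χ a) (χ (a + ρ))) →
             block ρ (spineOf χ) a ≡ lexMinPath ρ (χ a) (χ (a + ρ))
    block≡ {a} a<K ρ∣a ((_ , last≡ , _) , _) = ≡-by-at _ _ λ j j≤ρ →
      trans (at-block ρ (spineOf χ) a j j≤ρ)
        (trans (at-spineOf χ (ℕP.≤-trans (ℕP.+-monoʳ-≤ a j≤ρ) (ρ∣a<K⇒a+ρ≤K ρ∣a a<K))) (inner j j≤ρ))
      where
      inner : ∀ j → j ≤ ρ → vertex χ (a + j) ≡ at (lexMinPath ρ (χ a) (χ (a + ρ))) j
      inner j j≤ρ with ℕP.m≤n⇒m<n∨m≡n j≤ρ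
      ... | inj₁ j<ρ  = vertex-inside χ ρ∣a j<ρ
      ... | inj₂ j≡ρ  = subst (λ i → vertex χ (a + i) ≡ at (lexMinPath ρ (χ a) (χ (a + ρ))) i) (sym j≡ρ)
                          (trans (vertex-at-multiple χ (∣m∣n⇒∣m+n ρ∣a ∣-refl))
                                 (sym (trans (at-last (lexMinPath ρ (χ a) (χ (a + ρ)))) last≡)))

  module Induced (s : Spine n k) (induced : IsInducedSpine n k L ρ s) where

    block≡lexMinPath : ∀ {a} → a < K → ρ ∣ a → block ρ s a ≡ lexMinPath ρ (at s a) (at s (a + ρ))
    block≡lexMinPath a<K ρ∣a =
      lexMin-unique ρ (proj₂ induced _ a<K ρ∣a) (lexMinPath-lexMin ρ (proj₁ (proj₂ induced _ a<K ρ∣a)))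

    at≡vertex : ∀ t → t ≤ K → at s t ≡ vertex (at s) t
    at≡vertex t t≤K with offset t ℕ.≟ 0
    ... | yes offset≡0 =
      trans (cong (at s) (trans (sym (anchor+offset t)) (trans (cong (λ j → anchor t + j) offset≡0) (ℕP.+-identityʳ _))))
            (sym (vertex-at-anchor (at s) t offset≡0))
    ... | no  offset≢0 = trans (cong (at s) (sym (anchor+offset t)))
                           (trans (sym (at-block ρ s (anchor t) (offset t) (ℕP.<⇒≤ (offset<ρ t))))
                             (cong (λ p → at p (offset t)) (block≡lexMinPath anchor<K (ρ∣anchor t))))
      where
      anchor<K : anchor t < K
      anchor<K = ℕP.<-≤-trans (subst (anchor t <_) (anchor+offset t) (ℕP.m<m+n (anchor t) (ℕP.n≢0⇒n>0 offset≢0))) t≤K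

    ≡spineOf : s ≡ spineOf (at s)
    ≡spineOf = ≡-by-at s (spineOf (at s)) (λ t t≤K → trans (at≡vertex t t≤K) (sym (at-spineOf (at s) t≤K)))

    step-at : ∀ i → i < K → Step (at s i) (at s (suc i))
    step-at i i<K = subst₂ Step from to (monotone j)
      where
      a = anchor i
      j = fromℕ< (offset<ρ i)
      a<K : a < K
      a<K = ℕP.≤-<-trans (anchor≤ i) i<K
      monotone : MonotonePath (block ρ s a)
      monotone = proj₁ (proj₂ (proj₂ (proj₁ (proj₂ induced a a<K (ρ∣anchor i)))))
      lookup-block : ∀ o → lookup (block ρ s a) o ≡ at s (a + toℕ o)
      lookup-block = VecP.lookup∘tabulate (λ o → at s (a + toℕ o))
      toℕ-j : toℕ j ≡ offset i
      toℕ-j = FinP.toℕ-fromℕ< (offset<ρ i)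
      from : lookup (block ρ s a) (Fin.inject₁ j) ≡ at s i
      from = trans (lookup-block (Fin.inject₁ j))
                   (cong (at s) (trans (cong (λ o → a + o) (trans (FinP.toℕ-inject₁ j) toℕ-j)) (anchor+offset i)))
      to : lookup (block ρ s a) (Fin.suc j) ≡ at s (suc i)
      to = trans (lookup-block (Fin.suc j))
                 (cong (at s) (trans (cong (λ o → a + suc o) toℕ-j)
                                     (trans (ℕP.+-suc a (offset i)) (cong suc (anchor+offset i)))))

    wt-at : ∀ i → i ≤ K → wt (at s i) ≡ + i
    wt-at zero    _   = proj₂ (proj₁ induced 0 z≤n (divides 0 refl))
    wt-at (suc i) i<K with step-at i i<K
    ... | c , step≡ = trans (cong wt step≡) (trans (wt-⊕-unitVec (at s i) c)
                        (trans (cong (ℤ._+ 1ℤ) (wt-at i (ℕP.<⇒≤ i<K))) (ℤP.+-comm (+ i) 1ℤ)))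

-- Mixing spines around the window of α

≤ᵖ⇒≼ : ∀ {k} (x y : Point k) → x ≤ᵖ y ≡ true → x ≼ y
≤ᵖ⇒≼ []      []      _   = coordinatewise λ ()
≤ᵖ⇒≼ (a ∷ x) (b ∷ y) x≤y with a ℤ.≤ᵇ b in a≤b
... | true = coordinatewise λ { Fin.zero → ℤP.≤ᵇ⇒≤ (subst Bool.T (sym a≤b) tt) ; (Fin.suc c) → ≤-at (≤ᵖ⇒≼ x y x≤y) c }

≼⇒≤ᵖ : ∀ {k} {x y : Point k} → x ≼ y → x ≤ᵖ y ≡ true
≼⇒≤ᵖ {x = []}    {[]}    _   = refl
≼⇒≤ᵖ {x = a ∷ x} {b ∷ y} x≼y with a ℤ.≤ᵇ b in a≤b
... | true  = ≼⇒≤ᵖ (≼-tail x≼y)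
... | false = ⊥-elim (subst Bool.T a≤b (ℤP.≤⇒≤ᵇ (≤-at x≼y Fin.zero)))

lookup-any : ∀ {A : Set} {m} {v : A} (xs : Vec A m) (i : Fin m) → lookup xs i ≡ v → Any (_≡ v) xs
lookup-any xs i xs[i]≡v = Any.map (λ xs[i]≡x → trans (sym xs[i]≡x) xs[i]≡v) (∈-lookup i xs)

herringOnSpine-cong : ∀ {m k} (s s′ : Vec (Point k) (suc m)) j v i →
                      at s (suc i) ≡ at s′ (suc i) → at s (i ∸ 1) ≡ at s′ (i ∸ 1) →
                      herringOnSpine s j v i ≡ herringOnSpine s′ j v i
herringOnSpine-cong s s′ j v i next≡ prev≡ with ℕP.<-cmp i j
... | tri< _ _ _ = next≡
... | tri≈ _ _ _ = refl
... | tri> _ _ _ = prev≡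

multiples-<+ρ⇒≤ : ∀ ρ {a b} → ρ ∣ a → ρ ∣ b → a < b + ρ → a ≤ b
multiples-<+ρ⇒≤ ρ {a} {b} ρ∣a ρ∣b a<b+ρ with ℕP.≤-<-connex a b
... | inj₁ a≤b = a≤b
... | inj₂ b<a = ⊥-elim (ℕP.<-irrefl refl (ℕP.<-≤-trans a<b+ρ (+-ρ-≤ ρ ρ∣b ρ∣a b<a)))

module Window (n k L ρ : ℕ) {{ρ≢0 : NonZero ρ}} (ρ∣K : ρ ∣ topIndex n k) (k≢0 : NonZero k)
              (wide : + 4 ℤ.* + k ℤ.* + L ℤ.≤ + ρ) (α : ℕ) (α<K : α < topIndex n k) (ρ∣α : ρ ∣ α) where

  open Spines n k L ρ ρ∣K k≢0 wide

  private
    ρ>0 : 0 < ρ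
    ρ>0 = ℕ.>-nonZero⁻¹ ρ
    +ρ+ρ : ∀ x → x + ρ + ρ ≡ x + 2 * ρ
    +ρ+ρ x = double x ρ
      where
      double : ∀ x r → x + r + r ≡ x + 2 * r
      double = ℕ-Solver.solve-∀
    +2ρ+ρ : ∀ x → x + 2 * ρ + ρ ≡ x + 3 * ρ
    +2ρ+ρ x = triple x ρ
      where
      triple : ∀ x r → x + 2 * r + r ≡ x + 3 * r
      triple = ℕ-Solver.solve-∀
    ρ∣2ρ : ρ ∣ 2 * ρ
    ρ∣2ρ = ∣n⇒∣m*n 2 ∣-refl

  InWindow : ℕ → Set
  InWindow t = (α ≤ t + ρ) × (t ≤ α + 2 * ρ)

  inWindow? : ∀ t → Dec (InWindow t)
  inWindow? t = (α ℕ.≤? t + ρ) ×-dec (t ℕ.≤? α + 2 * ρ)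

  Far : ℕ → Set
  Far t = (t + 2 * ρ ≤ α) ⊎ (α + 3 * ρ ≤ t)

  far? : ∀ t → Dec (Far t)
  far? t = (t + 2 * ρ ℕ.≤? α) ⊎-dec (α + 3 * ρ ℕ.≤? t)

  window-connecting : ∀ {t b} → InWindow t → ρ ∣ b → t < b + ρ → b < t + ρ → InWindow b
  window-connecting {t} {b} (α≤t+ρ , t≤α+2ρ) ρ∣b t<b+ρ b<t+ρ =
    multiples-<+ρ⇒≤ ρ ρ∣α (∣m∣n⇒∣m+n ρ∣b ∣-refl) (ℕP.≤-<-trans α≤t+ρ (ℕP.+-monoˡ-< ρ t<b+ρ)) ,
    multiples-<+ρ⇒≤ ρ ρ∣b (∣m∣n⇒∣m+n ρ∣α ρ∣2ρ) (ℕP.<-≤-trans b<t+ρ (ℕP.+-monoˡ-≤ ρ t≤α+2ρ))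

  far-connecting : ∀ {t b} → Far t → b < t + ρ → t < b + ρ → ¬ InWindow b
  far-connecting {t} {b} (inj₁ t+2ρ≤α) b<t+ρ _ (α≤b+ρ , _) =
    ℕP.<-irrefl refl (ℕP.<-≤-trans (ℕP.+-monoˡ-< ρ b<t+ρ) (ℕP.≤-trans (ℕP.≤-reflexive (+ρ+ρ t)) (ℕP.≤-trans t+2ρ≤α α≤b+ρ)))
  far-connecting {t} {b} (inj₂ α+3ρ≤t) _ t<b+ρ (_ , b≤α+2ρ) =
    ℕP.<-irrefl refl (ℕP.<-≤-trans t<b+ρ (ℕP.≤-trans (ℕP.+-monoˡ-≤ ρ b≤α+2ρ) (ℕP.≤-trans (ℕP.≤-reflexive (+2ρ+ρ α)) α+3ρ≤t)))

  connect : Spine n k → Spine n k → ℕ → Point k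
  connect s s′ b with inWindow? b
  ... | yes _ = at s b
  ... | no  _ = at s′ b

  connect-inside : ∀ s s′ {b} → InWindow b → connect s s′ b ≡ at s b
  connect-inside s s′ {b} b∈W with inWindow? b
  ... | yes _   = refl
  ... | no  b∉W = ⊥-elim (b∉W b∈W)

  connect-outside : ∀ s s′ {b} → ¬ InWindow b → connect s s′ b ≡ at s′ b
  connect-outside s s′ {b} b∉W with inWindow? b
  ... | yes b∈W = ⊥-elim (b∉W b∈W)
  ... | no  _   = refl

  mix : Spine n k → Spine n k → Spine n k
  mix s s′ = spineOf (connect s s′)

  mix-induced : ∀ s s′ → IsInducedSpine n k L ρ s → IsInducedSpine n k L ρ s′ → IsInducedSpine n k L ρ (mix s s′)
  mix-induced s s′ induced induced′ = spineOf-induced (connect s s′) valid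
    where
    valid : ValidConnecting (connect s s′)
    valid a a≤K ρ∣a with inWindow? a
    ... | yes _ = proj₁ induced a a≤K ρ∣a
    ... | no  _ = proj₁ induced′ a a≤K ρ∣a

  mix-inside-≤K : ∀ s s′ → IsInducedSpine n k L ρ s → ∀ {t} → t ≤ K → InWindow t → at (mix s s′) t ≡ at s t
  mix-inside-≤K s s′ induced {t} t≤K t∈W =
    trans (at-spineOf (connect s s′) t≤K)
      (trans (vertex-cong (connect s s′) (at s) t
                (λ b ρ∣b t<b+ρ b<t+ρ → connect-inside s s′ (window-connecting t∈W ρ∣b t<b+ρ b<t+ρ)))
             (sym (Induced.at≡vertex s induced t t≤K)))

  mix-inside : ∀ s s′ → IsInducedSpine n k L ρ s → ∀ {t} → InWindow t → at (mix s s′) t ≡ at s t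
  mix-inside s s′ induced {t} t∈W with t ℕ.≤? K
  ... | yes t≤K = mix-inside-≤K s s′ induced t≤K t∈W
  ... | no  t≰K = trans (at-clamp (mix s s′) t K≤t)
                    (trans (mix-inside-≤K s s′ induced ℕP.≤-refl K∈W) (sym (at-clamp s t K≤t)))
    where
    K≤t = ℕP.<⇒≤ (ℕP.≰⇒> t≰K)
    K∈W : InWindow K
    K∈W = ℕP.≤-trans (ℕP.<⇒≤ α<K) (ℕP.m≤m+n K ρ) , ℕP.≤-trans K≤t (proj₂ t∈W)

  mix-outside : ∀ s s′ → IsInducedSpine n k L ρ s′ → ∀ {t} → t ≤ K → Far t → at (mix s s′) t ≡ at s′ t
  mix-outside s s′ induced′ {t} t≤K t-far =
    trans (at-spineOf (connect s s′) t≤K)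
      (trans (vertex-cong (connect s s′) (at s′) t
                (λ b ρ∣b t<b+ρ b<t+ρ → connect-outside s s′ (far-connecting t-far b<t+ρ t<b+ρ)))
             (sym (Induced.at≡vertex s′ induced′ t t≤K)))

  spineOf-cong : ∀ χ χ′ → (∀ b → b ≤ K → ρ ∣ b → χ b ≡ χ′ b) → spineOf χ ≡ spineOf χ′
  spineOf-cong χ χ′ agree = VecP.tabulate-cong λ i →
    vertex-cong χ χ′ (toℕ i) λ b ρ∣b _ b<i+ρ →
      agree b (multiples-<+ρ⇒≤ ρ ρ∣b ρ∣K (ℕP.<-≤-trans b<i+ρ (ℕP.+-monoˡ-≤ ρ (ℕP.≤-pred (FinP.toℕ<n i))))) ρ∣b

  mix-involutive : ∀ s s′ → IsInducedSpine n k L ρ s → mix (mix s s′) (mix s′ s) ≡ s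
  mix-involutive s s′ induced = trans (spineOf-cong _ (at s) connect-back) (sym (Induced.≡spineOf s induced))
    where
    connect-back : ∀ b → b ≤ K → ρ ∣ b → connect (mix s s′) (mix s′ s) b ≡ at s b
    connect-back b b≤K ρ∣b with inWindow? b
    ... | yes b∈W = trans (spineOf-at-multiple (connect s s′) b≤K ρ∣b) (connect-inside s s′ b∈W)
    ... | no  b∉W = trans (spineOf-at-multiple (connect s′ s) b≤K ρ∣b) (connect-outside s′ s b∉W)

  near-weight⇒near-index : ∀ {b t} → ρ ∣ b → b ≤ t → t ≤ b + ρ → ¬ Far t → NearIndex α ρ b
  near-weight⇒near-index {b} {t} ρ∣b b≤t t≤b+ρ t-near with ℕP.<-cmp b α
  ... | tri≈ _ b≡α _ = inj₂ (inj₂ (inj₁ b≡α))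
  ... | tri< b<α _ _ with ℕP.m≤n⇒m<n∨m≡n (+-ρ-≤ ρ ρ∣b ρ∣α b<α)
  ...   | inj₂ b+ρ≡α = inj₂ (inj₁ b+ρ≡α)
  ...   | inj₁ b+ρ<α = inj₁ (ℕP.≤-antisym (subst (_≤ α) (+ρ+ρ b) (+-ρ-≤ ρ (∣m∣n⇒∣m+n ρ∣b ∣-refl) ρ∣α b+ρ<α)) α≤b+2ρ)
    where
    α≤b+2ρ : α ≤ b + 2 * ρ
    α≤b+2ρ = multiples-<+ρ⇒≤ ρ ρ∣α (∣m∣n⇒∣m+n ρ∣b ρ∣2ρ)
               (ℕP.<-≤-trans (ℕP.≰⇒> (t-near ∘ inj₁))
                 (subst (t + 2 * ρ ≤_) (trans (sym (+ρ+ρ (b + ρ))) (cong (_+ ρ) (+ρ+ρ b))) (ℕP.+-monoˡ-≤ (2 * ρ) t≤b+ρ)))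
  near-weight⇒near-index {b} {t} ρ∣b b≤t t≤b+ρ t-near | tri> _ _ α<b with ℕP.m≤n⇒m<n∨m≡n (+-ρ-≤ ρ ρ∣α ρ∣b α<b)
  ...   | inj₂ α+ρ≡b = inj₂ (inj₂ (inj₂ (inj₁ (sym α+ρ≡b))))
  ...   | inj₁ α+ρ<b = inj₂ (inj₂ (inj₂ (inj₂ (ℕP.≤-antisym b≤α+2ρ
                          (subst (_≤ b) (+ρ+ρ α) (+-ρ-≤ ρ (∣m∣n⇒∣m+n ρ∣α ∣-refl) ρ∣b α+ρ<b))))))
    where
    b≤α+2ρ : b ≤ α + 2 * ρ
    b≤α+2ρ = multiples-<+ρ⇒≤ ρ ρ∣b (∣m∣n⇒∣m+n ρ∣α ρ∣2ρ)
               (ℕP.≤-<-trans b≤t (subst (t <_) (sym (+2ρ+ρ α)) (ℕP.≰⇒> (t-near ∘ inj₂))))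

  otherVertex : Point k → Maybe (Point k)
  otherVertex x = if does (inOtherRegion? n k L ρ α x) then just x else nothing

  otherVertex-near : ∀ x {t} → wt x ≡ + t → ¬ Far t → otherVertex x ≡ nothing
  otherVertex-near x {t} wt-x t-near with inOtherRegion? n k L ρ α x
  ... | no  _ = refl
  ... | yes (b , ρ∣b , b-far , _ , b≤wt , wt≤b+ρ) = ⊥-elim (b-far (near-weight⇒near-index ρ∣b
          (ℤP.drop‿+≤+ (subst (+ toℕ b ℤ.≤_) wt-x b≤wt)) (ℤP.drop‿+≤+ (subst (ℤ._≤ + (toℕ b + ρ)) wt-x wt≤b+ρ)) t-near))

  otherSpineVertices-local : ∀ s s′ → IsInducedSpine n k L ρ s → IsInducedSpine n k L ρ s′ →
                             (∀ {t} → t ≤ K → Far t → at s t ≡ at s′ t) →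
                             otherSpineVertices n k L ρ α s ≡ otherSpineVertices n k L ρ α s′
  otherSpineVertices-local s s′ induced induced′ agree =
    trans (sym (VecP.tabulate∘lookup _)) (trans (VecP.tabulate-cong pointwise) (VecP.tabulate∘lookup _))
    where
    pointwise : ∀ i → lookup (otherSpineVertices n k L ρ α s) i ≡ lookup (otherSpineVertices n k L ρ α s′) i
    pointwise i = trans (VecP.lookup-map i otherVertex s)
                    (trans (subst₂ (λ x y → otherVertex x ≡ otherVertex y) (at-lookup s i) (at-lookup s′ i) by-weight)
                           (sym (VecP.lookup-map i otherVertex s′)))
      where
      t = toℕ i
      t≤K : t ≤ K
      t≤K = ℕP.≤-pred (FinP.toℕ<n i)
      by-weight : otherVertex (at s t) ≡ otherVertex (at s′ t)
      by-weight with far? t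
      ... | yes t-far  = cong otherVertex (agree t≤K t-far)
      ... | no  t-near = trans (otherVertex-near (at s t) (Induced.wt-at s induced t t≤K) t-near)
                               (sym (otherVertex-near (at s′ t) (Induced.wt-at s′ induced′ t t≤K) t-near))

  private
    α∸ρ+ρ≥α : α ≤ α ∸ ρ + ρ
    α∸ρ+ρ≥α = subst (α ≤_) (ℕP.+-comm ρ (α ∸ ρ)) (ℕP.m≤n+m∸n α ρ)

    window-between : ∀ {t} → α ∸ ρ ≤ t → t ≤ α + 2 * ρ → InWindow t
    window-between α∸ρ≤t t≤ = ℕP.≤-trans α∸ρ+ρ≥α (ℕP.+-monoˡ-≤ ρ α∸ρ≤t) , t≤

    window-suc : ∀ {t} → α ∸ ρ ≤ t → t ≤ α + ρ → InWindow (suc t)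
    window-suc {t} α∸ρ≤t t≤α+ρ =
      window-between (ℕP.m≤n⇒m≤1+n α∸ρ≤t)
        (ℕP.≤-trans (s≤s t≤α+ρ)
          (subst (suc (α + ρ) ≤_) (+ρ+ρ α) (subst (_≤ α + ρ + ρ) (ℕP.+-comm (α + ρ) 1) (ℕP.+-monoʳ-≤ (α + ρ) ρ>0))))

    window-pred : ∀ {t} → α ≤ t → t ≤ α + 2 * ρ → InWindow (t ∸ 1)
    window-pred {t} α≤t t≤ =
      ℕP.≤-trans α≤t (ℕP.≤-trans (subst (t ≤_) (ℕP.+-comm 1 (t ∸ 1)) (ℕP.m≤n+m∸n t 1)) (ℕP.+-monoʳ-≤ (t ∸ 1) ρ>0)) ,
      ℕP.≤-trans (ℕP.m∸n≤m t 1) t≤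

  -- wt s^i = i and the tube forces s^{α-ρ} ≤ v ≤ s^{α+2ρ}, so μ(v) ∈ [α - ρ, wt v] and M(v) ∈ [α, α + 2ρ].
  module _ (v : Point k) (v∈R : InRegion n L ρ α v) where

    private
      wv : ℕ
      wv = ℤ.∣ wt v ∣
      wt-v : wt v ≡ + wv
      wt-v = sym (ℤP.0≤i⇒+∣i∣≡i (ℤP.≤-trans (0≤+ α) (proj₁ (proj₂ v∈R))))
      α≤wv : α ≤ wv
      α≤wv = ℤP.drop‿+≤+ (subst (+ α ℤ.≤_) wt-v (proj₁ (proj₂ v∈R)))
      wv≤α+ρ : wv ≤ α + ρ
      wv≤α+ρ = ℤP.drop‿+≤+ (subst (ℤ._≤ + (α + ρ)) wt-v (proj₂ (proj₂ v∈R)))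
      wv≤K : wv ≤ K
      wv≤K = ℕP.≤-trans wv≤α+ρ (ρ∣a<K⇒a+ρ≤K ρ∣α α<K)
      α+ρ≤α+2ρ : α + ρ ≤ α + 2 * ρ
      α+ρ≤α+2ρ = ℕP.+-monoʳ-≤ α (ℕP.m≤m+n ρ (ρ + 0))

      module Compare (s : Spine n k) (induced : IsInducedSpine n k L ρ s) where

        open Induced s induced using (wt-at)

        not-above-v : ∀ i → i < α → (v ≤ᵖ at s i) ≡ false
        not-above-v i i<α with v ≤ᵖ at s i in v≤s[i]
        ... | false = refl
        ... | true  = ⊥-elim (ℕP.<-irrefl refl (ℕP.<-≤-trans i<α (ℕP.≤-trans α≤wv wv≤i)))
          where
          wv≤i : wv ≤ i
          wv≤i = ℤP.drop‿+≤+ (subst₂ ℤ._≤_ wt-v (wt-at i (ℕP.<⇒≤ (ℕP.<-trans i<α α<K))) (wt-mono (≤ᵖ⇒≼ v (at s i) v≤s[i])))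

        not-below-v : ∀ i → wv < i → i ≤ K → (at s i ≤ᵖ v) ≡ false
        not-below-v i wv<i i≤K with at s i ≤ᵖ v in s[i]≤v
        ... | false = refl
        ... | true  = ⊥-elim (ℕP.<-irrefl refl (ℕP.<-≤-trans wv<i i≤wv))
          where
          i≤wv : i ≤ wv
          i≤wv = ℤP.drop‿+≤+ (subst₂ ℤ._≤_ (wt-at i i≤K) wt-v (wt-mono (≤ᵖ⇒≼ (at s i) v s[i]≤v)))

        above-v : α + 2 * ρ ≤ K → (v ≤ᵖ at s (α + 2 * ρ)) ≡ true
        above-v α+2ρ≤K = ≼⇒≤ᵖ (tube-≼ n L k≢0 (proj₁ v∈R) (proj₁ low)
          (ℤP.≤-trans (ℤP.+-mono-≤ (proj₂ (proj₂ v∈R)) wide) (ℤP.≤-reflexive (sym (trans (proj₂ low) (cong +_ (sym (+ρ+ρ α))))))))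
          where
          low : InLow n L (α + 2 * ρ) (at s (α + 2 * ρ))
          low = proj₁ induced (α + 2 * ρ) α+2ρ≤K (∣m∣n⇒∣m+n ρ∣α ρ∣2ρ)

        below-v : ρ ≤ α → (at s (α ∸ ρ) ≤ᵖ v) ≡ true
        below-v ρ≤α = ≼⇒≤ᵖ (tube-≼ n L k≢0 (proj₁ low) (proj₁ v∈R)
          (ℤP.≤-trans (ℤP.+-mono-≤ (ℤP.≤-reflexive (proj₂ low)) wide)
                      (subst (ℤ._≤ wt v) (cong +_ (sym (ℕP.m∸n+n≡m ρ≤α))) (proj₁ (proj₂ v∈R)))))
          where
          low : InLow n L (α ∸ ρ) (at s (α ∸ ρ))
          low = proj₁ induced (α ∸ ρ) (ℕP.≤-trans (ℕP.m∸n≤m α ρ) (ℕP.<⇒≤ α<K))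
                  (∣m+n∣m⇒∣n (subst (ρ ∣_) (sym (ℕP.m+[n∸m]≡n ρ≤α)) ρ∣α) ∣-refl)

        index≡wv : (v∈s : Any (_≡ v) s) → toℕ (Any.index v∈s) ≡ wv
        index≡wv v∈s = ℤP.+-injective (trans (sym (wt-at (toℕ i) (ℕP.≤-pred (FinP.toℕ<n i))))
                         (trans (cong wt (trans (at-lookup s i) (AnyP.lookup-index v∈s))) wt-v))
          where i = Any.index v∈s

        at-wv : Any (_≡ v) s → at s wv ≡ v
        at-wv v∈s = subst (λ t → at s t ≡ v) (index≡wv v∈s) (trans (at-lookup s (Any.index v∈s)) (AnyP.lookup-index v∈s))

      wv≤α+2ρ : wv ≤ α + 2 * ρ
      wv≤α+2ρ = ℕP.≤-trans wv≤α+ρ α+ρ≤α+2ρ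
      α∸ρ≤wv : α ∸ ρ ≤ wv
      α∸ρ≤wv = ℕP.≤-trans (ℕP.m∸n≤m α ρ) α≤wv
      wv∈W : InWindow wv
      wv∈W = window-between α∸ρ≤wv wv≤α+2ρ
      on-spine : ∀ s → at s wv ≡ v → Any (_≡ v) s
      on-spine s at≡v = lookup-any s (fromℕ< (s≤s wv≤K))
        (trans (sym (trans (cong (at s) (sym (FinP.toℕ-fromℕ< (s≤s wv≤K)))) (at-lookup s (fromℕ< (s≤s wv≤K))))) at≡v)

      μ-floor : ∀ s → IsInducedSpine n k L ρ s → Floor (λ i → at s i ≤ᵖ v) (α ∸ ρ)
      μ-floor s induced with ρ ℕ.≤? α
      ... | yes ρ≤α = inj₂ (Compare.below-v s induced ρ≤α)
      ... | no  ρ≰α = inj₁ (ℕP.m≤n⇒m∸n≡0 (ℕP.<⇒≤ (ℕP.≰⇒> ρ≰α)))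

      α∸ρ≤K : α ∸ ρ ≤ K
      α∸ρ≤K = ℕP.≤-trans (ℕP.m∸n≤m α ρ) (ℕP.<⇒≤ α<K)

      smallμ-bounds : ∀ s → IsInducedSpine n k L ρ s → (α ∸ ρ ≤ smallμ s v) × (smallμ s v ≤ wv)
      smallμ-bounds s induced = searchDown-≥ p K (μ-floor s induced) α∸ρ≤K , upper (searchDown-floor p K)
        where
        p = λ i → at s i ≤ᵖ v
        upper : Floor p (smallμ s v) → smallμ s v ≤ wv
        upper (inj₁ μ≡0) = subst (_≤ wv) (sym μ≡0) z≤n
        upper (inj₂ hit) = ℤP.drop‿+≤+ (subst₂ ℤ._≤_ (Induced.wt-at s induced _ (searchDown-≤ p K)) wt-v
                                                       (wt-mono (≤ᵖ⇒≼ (at s (smallμ s v)) v hit)))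

      smallμ-local : ∀ s s′ → IsInducedSpine n k L ρ s → IsInducedSpine n k L ρ s′ →
                     (∀ {t} → InWindow t → at s t ≡ at s′ t) → smallμ s v ≡ smallμ s′ v
      smallμ-local s s′ induced induced′ agree =
        searchDown-cong (λ i → at s i ≤ᵖ v) (λ i → at s′ i ≤ᵖ v) K same (μ-floor s induced) α∸ρ≤K
        where
        same : ∀ i → α ∸ ρ ≤ i → i ≤ K → (at s i ≤ᵖ v) ≡ (at s′ i ≤ᵖ v)
        same i α∸ρ≤i i≤K with i ℕ.≤? α + 2 * ρ
        ... | yes i≤ = cong (_≤ᵖ v) (agree (window-between α∸ρ≤i i≤))
        ... | no  i≰ = trans (Compare.not-below-v s induced i wv<i i≤K) (sym (Compare.not-below-v s′ induced′ i wv<i i≤K))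
          where wv<i = ℕP.≤-<-trans (ℕP.≤-trans wv≤α+ρ α+ρ≤α+2ρ) (ℕP.≰⇒> i≰)

      M-ceiling : ∀ s → IsInducedSpine n k L ρ s → Ceiling (λ i → v ≤ᵖ at s i) K 0 (α + 2 * ρ)
      M-ceiling s induced = Compare.above-v s induced

      bigM-bounds : ∀ s → IsInducedSpine n k L ρ s → (α ≤ bigM s v) × (bigM s v ≤ α + 2 * ρ)
      bigM-bounds s induced = lower (searchUp-hit q K 0) , searchUp-≤-ceiling q K 0 z≤n (M-ceiling s induced)
        where
        q = λ i → v ≤ᵖ at s i
        lower : (bigM s v ≡ 0 + K) ⊎ (q (bigM s v) ≡ true) → α ≤ bigM s v
        lower (inj₁ M≡K) = subst (α ≤_) (sym M≡K) (ℕP.<⇒≤ α<K)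
        lower (inj₂ hit) = ℕP.≤-trans α≤wv (ℤP.drop‿+≤+ (subst₂ ℤ._≤_ wt-v (Induced.wt-at s induced _ (searchUp-≤ q K 0))
                                                                    (wt-mono (≤ᵖ⇒≼ v (at s (bigM s v)) hit))))

      bigM-local : ∀ s s′ → IsInducedSpine n k L ρ s → IsInducedSpine n k L ρ s′ →
                   (∀ {t} → InWindow t → at s t ≡ at s′ t) → bigM s v ≡ bigM s′ v
      bigM-local s s′ induced induced′ agree =
        searchUp-cong (λ i → v ≤ᵖ at s i) (λ i → v ≤ᵖ at s′ i) K 0 z≤n same (M-ceiling s induced)
        where
        same : ∀ i → 0 ≤ i → i ≤ α + 2 * ρ → (v ≤ᵖ at s i) ≡ (v ≤ᵖ at s′ i)
        same i _ i≤ with i ℕ.<? α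
        ... | yes i<α = trans (Compare.not-above-v s induced i i<α) (sym (Compare.not-above-v s′ induced′ i i<α))
        ... | no  i≮α = cong (v ≤ᵖ_) (agree (ℕP.≤-trans (ℕP.≮⇒≥ i≮α) (ℕP.m≤m+n i ρ) , i≤))

    herringbone-local : ∀ s s′ → IsInducedSpine n k L ρ s → IsInducedSpine n k L ρ s′ →
                        (∀ {t} → InWindow t → at s t ≡ at s′ t) → ∀ j → herringbone s j v ≡ herringbone s′ j v
    herringbone-local s s′ induced induced′ agree j with Any.any? (_≟ᵖ v) s | Any.any? (_≟ᵖ v) s′
    ... | yes v∈s | yes v∈s′ =
      trans (cong (herringOnSpine s j v) (Compare.index≡wv s induced v∈s))
        (trans (herringOnSpine-cong s s′ j v wv (agree (window-suc α∸ρ≤wv wv≤α+ρ)) (agree (window-pred α≤wv wv≤α+2ρ)))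
               (cong (herringOnSpine s′ j v) (sym (Compare.index≡wv s′ induced′ v∈s′))))
    ... | yes v∈s | no  v∉s′ = ⊥-elim (v∉s′ (on-spine s′ (trans (sym (agree wv∈W)) (Compare.at-wv s induced v∈s))))
    ... | no  v∉s | yes v∈s′ = ⊥-elim (v∉s (on-spine s (trans (agree wv∈W) (Compare.at-wv s′ induced′ v∈s′))))
    ... | no  _   | no  _    =
      trans (cong₂ _⊖_ (cong₂ (λ x y → v ⊕ (x ⊖ y)) (agree (window-suc α∸ρ≤μ μ≤α+ρ)) (agree (window-between α∸ρ≤μ μ≤α+2ρ)))
                       (cong₂ _⊖_ (agree (ℕP.≤-trans α≤M (ℕP.m≤m+n M ρ) , M≤α+2ρ)) (agree (window-pred α≤M M≤α+2ρ))))
            (cong₂ (λ μ M → (v ⊕ (at s′ (suc μ) ⊖ at s′ μ)) ⊖ (at s′ M ⊖ at s′ (M ∸ 1)))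
                   (smallμ-local s s′ induced induced′ agree) (bigM-local s s′ induced induced′ agree))
      where
      μ = smallμ s v
      M = bigM s v
      α∸ρ≤μ = proj₁ (smallμ-bounds s induced)
      μ≤α+ρ = ℕP.≤-trans (proj₂ (smallμ-bounds s induced)) wv≤α+ρ
      μ≤α+2ρ = ℕP.≤-trans μ≤α+ρ α+ρ≤α+2ρ
      α≤M = proj₁ (bigM-bounds s induced)
      M≤α+2ρ = proj₂ (bigM-bounds s induced)

lemma8 : (n k L ρ : ℕ) → NonZero n → NonZero k → NonZero L → NonZero ρ →
         ρ ∣ topIndex n k → k ∣ ρ → 12 * k * L ≤ ρ →
         (α : ℕ) → α < topIndex n k → ρ ∣ α →
         (v : Point k) → InGrid n v → InRegion n L ρ α v →
         (ℓ : List (Spine n k)) → Unique ℓ →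
         ((s : Spine n k) → (s ∈ ℓ) ⇔ IsInducedSpine n k L ρ s) →
         IndependentUniform (sampleSpace n k ℓ)
           (λ sj → herringbone (proj₁ sj) (toℕ (proj₂ sj)) v) _≟ᵖ_
           (λ sj → otherSpineVertices n k L ρ α (proj₁ sj)) _≟ᵒ_
lemma8 n k L ρ _ k≢0 _ ρ≢0 ρ∣K _ 12kL≤ρ α α<K ρ∣α v _ v∈R ℓ unique ℓ≡Ψ =
  independent-by-swapping (VecP.≡-dec _≟ᵖ_) ℓ unique (allFin (suc (topIndex n k)))
    (λ sj → herringbone (proj₁ sj) (toℕ (proj₂ sj)) v) _≟ᵖ_ (otherSpineVertices n k L ρ α) _≟ᵒ_
    mix mix∈ℓ same-value same-far-vertices (λ {s} {s′} s∈ _ → mix-involutive s s′ (induced s∈))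
  where
  instance
    _ = ρ≢0
  4kL≤ρ : + 4 ℤ.* + k ℤ.* + L ℤ.≤ + ρ
  4kL≤ρ = subst (ℤ._≤ + ρ) (trans (ℤP.pos-* (4 * k) L) (cong (ℤ._* + L) (ℤP.pos-* 4 k)))
            (ℤ.+≤+ (ℕP.≤-trans (ℕP.*-monoˡ-≤ L (ℕP.*-monoˡ-≤ k (ℕP.m≤m+n 4 8))) 12kL≤ρ))
  open Window n k L ρ ρ∣K k≢0 4kL≤ρ α α<K ρ∣α

  induced : ∀ {s} → s ∈ ℓ → IsInducedSpine n k L ρ s
  induced {s} = Equivalence.to (ℓ≡Ψ s)

  mixed : ∀ {s s′} → s ∈ ℓ → s′ ∈ ℓ → IsInducedSpine n k L ρ (mix s s′)
  mixed {s} {s′} s∈ s′∈ = mix-induced s s′ (induced s∈) (induced s′∈)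

  mix∈ℓ : ∀ {s s′} → s ∈ ℓ → s′ ∈ ℓ → mix s s′ ∈ ℓ
  mix∈ℓ s∈ s′∈ = Equivalence.from (ℓ≡Ψ _) (mixed s∈ s′∈)

  same-value : ∀ {s s′} → s ∈ ℓ → s′ ∈ ℓ → ∀ j → herringbone (mix s s′) (toℕ j) v ≡ herringbone s (toℕ j) v
  same-value {s} {s′} s∈ s′∈ j =
    herringbone-local v v∈R (mix s s′) s (mixed s∈ s′∈) (induced s∈) (mix-inside s s′ (induced s∈)) (toℕ j)

  same-far-vertices : ∀ {s s′} → s ∈ ℓ → s′ ∈ ℓ →
                      otherSpineVertices n k L ρ α (mix s s′) ≡ otherSpineVertices n k L ρ α s′
  same-far-vertices {s} {s′} s∈ s′∈ =
    otherSpineVertices-local (mix s s′) s′ (mixed s∈ s′∈) (induced s′∈) (mix-outside s s′ (induced s′∈))
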